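{- Let $k\in\mathbb{Z}^+$ and $m\in\mathbb{N}$. Then $$\sum_{\substack{i_1,\ldots,i_k\in\mathbb{N}\\ \sum_{j=1}^k i_jj=k}}(-1)^{i_1+\cdots+i_k}\frac{(\sum_{j=1}^ki_j-1)!}{i_1!\cdots i_k!}\prod_{j=1}^k\left(\frac{B^{(m)}_j}{j!}\right)^{i_j}=m\frac{(-1)^kB_k}{k!\,k}.$$
   Context: For $m\in\mathbb{N}$ the $m$th order Bernoulli numbers $B^{(m)}_j$ are defined by $\left(\frac{x}{e^x-1}\right)^m=\sum_{j\ge0}B^{(m)}_j\frac{x^j}{j!}$, and $B_k=B^{(1)}_k$. -}

module Defs where

open import Data.Nat as ℕ using (ℕ; zero; suc; _∸_; NonZero)
open import Data.Nat.Properties using (_!≢0)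
open import Data.Nat using (_!)
open import Data.Integer using (+_)
open import Data.Rational using (ℚ; 0ℚ; 1ℚ; _+_; _*_; -_; _/_)
open import Data.List using (List; []; _∷_; _++_; [_]; map; concatMap; filter; upTo; foldr)
open import Data.Vec using (Vec; []; _∷_)
open import Relation.Binary.PropositionalEquality using (_≡_)

invFact : ℕ → ℚ
invFact n = _/_ (+ 1) (n !) {{n !≢0}}

factℚ : ℕ → ℚ
factℚ n = (+ (n !)) / 1

_^ℚ_ : ℚ → ℕ → ℚ
q ^ℚ zero = 1ℚ
q ^ℚ suc n = q * (q ^ℚ n)

sgn : ℕ → ℚ
sgn n = (- 1ℚ) ^ℚ n

-- Formal power series over ℚ, as coefficient functions
Series : Set
Series = ℕ → ℚ

sumTo : ℕ → (ℕ → ℚ) → ℚ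
sumTo zero f = f 0
sumTo (suc n) f = sumTo n f + f (suc n)

_⊛_ : Series → Series → Series
(f ⊛ g) n = sumTo n (λ i → f i * g (n ∸ i))

-- (e^x - 1)/x = Σ_j x^j/(j+1)!
expm1Over : Series
expm1Over j = invFact (suc j)

nth : List ℚ → ℕ → ℚ
nth [] _ = 0ℚ
nth (x ∷ xs) zero = x
nth (x ∷ xs) (suc n) = nth xs n

-- first (n+1) coefficients g_0..g_n of x/(e^x - 1) = 1/((e^x-1)/x),
-- via g_0 = 1, g_n = - Σ_{i=1}^{n} a_i g_{n-i}   (a = expm1Over, a_0 = 1)
tdCoeffs : ℕ → List ℚ
tdCoeffs zero = [ 1ℚ ]
tdCoeffs (suc n) =
  let gs = tdCoeffs n in
  gs ++ [ - sumTo n (λ i → expm1Over (suc i) * nth gs (n ∸ i)) ]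

-- the power series x/(e^x - 1)
todd : Series
todd n = nth (tdCoeffs n) n

toddPow : ℕ → Series
toddPow zero zero = 1ℚ
toddPow zero (suc n) = 0ℚ
toddPow (suc m) = todd ⊛ toddPow m

-- m-th order Bernoulli numbers: (x/(e^x-1))^m = Σ_j B^(m)_j x^j / j!
B[_]_ : ℕ → ℕ → ℚ
B[ m ] j = factℚ j * toddPow m j

Bern : ℕ → ℚ
Bern k = B[ 1 ] k

allVecs : ℕ → (n : ℕ) → List (Vec ℕ n)
allVecs b zero = [] ∷ []
allVecs b (suc n) = concatMap (λ x → map (x ∷_) (allVecs b n)) (upTo (suc b))

wsum : ℕ → {n : ℕ} → Vec ℕ n → ℕ
wsum j [] = 0
wsum j (x ∷ xs) = j ℕ.* x ℕ.+ wsum (suc j) xs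

vsum : {n : ℕ} → Vec ℕ n → ℕ
vsum [] = 0
vsum (x ∷ xs) = x ℕ.+ vsum xs

-- all (i_1,…,i_k) ∈ ℕ^k with Σ_j j·i_j = k   (necessarily i_j ≤ k)
tuples : (k : ℕ) → List (Vec ℕ k)
tuples k = filter (λ v → wsum 1 v ℕ.≟ k) (allVecs k k)

prodTerm : ℕ → ℕ → {n : ℕ} → Vec ℕ n → ℚ
prodTerm m j [] = 1ℚ
prodTerm m j (x ∷ xs) =
  invFact x * (((B[ m ] j) * invFact j) ^ℚ x) * prodTerm m (suc j) xs

term : ℕ → {n : ℕ} → Vec ℕ n → ℚ
term m v = sgn (vsum v) * factℚ (vsum v ∸ 1) * prodTerm m 1 v

sumℚ : List ℚ → ℚ
sumℚ = foldr _+_ 0ℚ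

LHS : ℕ → ℕ → ℚ
LHS k m = sumℚ (map (term m) (tuples k))

module Submission where

-- Let t = x/(eˣ − 1), a = tᵐ = Σ_j B⁽ᵐ⁾_j xʲ/j! and g = a − 1.  Grouping the tuples (i_j) by
-- s = Σ_j i_j, the multinomial theorem turns the left-hand side into
-- Σ_s (−1)ˢ (s − 1)!/s! [xᵏ] gˢ = −[xᵏ] log (1 + g) = −[xᵏ] log a.
-- For the Euler operator θ = x d/dx, log a is determined by a · θ (log a) = θ a.  Differentiating
-- (eˣ − 1)/x · t = 1 and using t(−x) = eˣ t gives θ t = t (1 − t(−x)), hence θ (log a) = m (1 − t(−x)),
-- and the coefficient of xᵏ (k ≥ 1) reads k [xᵏ] log a = −m (−1)ᵏ B_k / k!.

open import Defs
open import Data.Nat as ℕ using (ℕ; zero; suc; _∸_; NonZero; _!; z≤n; s≤s)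
open import Data.Nat.Properties as ℕP using (_!≢0; _!*_!≢0)
open import Data.Nat.Combinatorics using (_C_; nCk≡n!/k![n-k]!; k>n⇒nCk≡0; k![n∸k]!∣n!)
open import Data.Nat.DivMod using (m/n*n≡m)
open import Data.Integer as ℤ using (+_)
import Data.Integer.Properties as ℤP
open import Data.Rational using (ℚ; 0ℚ; 1ℚ; _+_; _*_; -_; _/_; toℚᵘ; fromℚᵘ)
open import Data.Rational.Properties as ℚP using ()
import Data.Rational.Unnormalised as ℚᵘ
import Data.Rational.Unnormalised.Properties as ℚᵘP
open import Data.Rational.Solver using (module +-*-Solver)
open +-*-Solver using (solve; _:=_; _:+_; _:*_; :-_; con)
open import Data.Bool using (if_then_else_)
open import Data.Fin using (toℕ)
open import Data.List using (List; []; _∷_; _++_; [_]; length; map; concatMap; filter; applyUpTo; upTo)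
open import Data.List.Properties using (length-++)
open import Data.Product using (_,_)
open import Data.Sum using (inj₁; inj₂)
open import Data.Vec using (Vec; []; _∷_)
open import Function using (_∘_; id)
open import Level using (0ℓ)
open import Relation.Binary.Bundles using (Setoid)
open import Relation.Binary.Definitions using (tri<; tri≈; tri>)
open import Relation.Binary.PropositionalEquality hiding ([_])
import Relation.Binary.Reasoning.Setoid as SetoidReasoning
open import Relation.Binary.Structures using (IsEquivalence)
open import Relation.Nullary using (Dec; yes; no; does; ¬_; contradiction)
open import Relation.Nullary.Decidable using (dec-true; dec-false)
open import Relation.Unary using (Decidable)
open import Algebra.Bundles using (CommutativeRing)

fromℚᵘ-homo-+ : ∀ p q → fromℚᵘ (p ℚᵘ.+ q) ≡ fromℚᵘ p + fromℚᵘ q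
fromℚᵘ-homo-+ p q = ℚP.toℚᵘ-injective (begin
  toℚᵘ (fromℚᵘ (p ℚᵘ.+ q))                ≈⟨ ℚP.toℚᵘ-fromℚᵘ (p ℚᵘ.+ q) ⟩
  p ℚᵘ.+ q                                ≈⟨ ℚᵘP.+-cong (ℚP.toℚᵘ-fromℚᵘ p) (ℚP.toℚᵘ-fromℚᵘ q) ⟨
  toℚᵘ (fromℚᵘ p) ℚᵘ.+ toℚᵘ (fromℚᵘ q)    ≈⟨ ℚP.toℚᵘ-homo-+ (fromℚᵘ p) (fromℚᵘ q) ⟨
  toℚᵘ (fromℚᵘ p + fromℚᵘ q)              ∎)
  where open ℚᵘP.≃-Reasoning

fromℚᵘ-homo-* : ∀ p q → fromℚᵘ (p ℚᵘ.* q) ≡ fromℚᵘ p * fromℚᵘ q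
fromℚᵘ-homo-* p q = ℚP.toℚᵘ-injective (begin
  toℚᵘ (fromℚᵘ (p ℚᵘ.* q))                ≈⟨ ℚP.toℚᵘ-fromℚᵘ (p ℚᵘ.* q) ⟩
  p ℚᵘ.* q                                ≈⟨ ℚᵘP.*-cong (ℚP.toℚᵘ-fromℚᵘ p) (ℚP.toℚᵘ-fromℚᵘ q) ⟨
  toℚᵘ (fromℚᵘ p) ℚᵘ.* toℚᵘ (fromℚᵘ q)    ≈⟨ ℚP.toℚᵘ-homo-* (fromℚᵘ p) (fromℚᵘ q) ⟨
  toℚᵘ (fromℚᵘ p * fromℚᵘ q)              ∎)
  where open ℚᵘP.≃-Reasoning

fromℕ : ℕ → ℚ
fromℕ n = + n / 1

ℕᵘ : ℕ → ℚᵘ.ℚᵘ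
ℕᵘ n = ℚᵘ.mkℚᵘ (+ n) 0

fromℕ-homo-+ : ∀ a b → fromℕ (a ℕ.+ b) ≡ fromℕ a + fromℕ b
fromℕ-homo-+ a b = begin
  fromℚᵘ (ℕᵘ (a ℕ.+ b))      ≡⟨ ℚP.fromℚᵘ-cong {ℕᵘ (a ℕ.+ b)} {ℕᵘ a ℚᵘ.+ ℕᵘ b} (ℚᵘ.*≡* eq) ⟩
  fromℚᵘ (ℕᵘ a ℚᵘ.+ ℕᵘ b)    ≡⟨ fromℚᵘ-homo-+ (ℕᵘ a) (ℕᵘ b) ⟩
  fromℕ a + fromℕ b          ∎
  where
  open ≡-Reasoning
  eq : + (a ℕ.+ b) ℤ.* + 1 ≡ (+ a ℤ.* + 1 ℤ.+ + b ℤ.* + 1) ℤ.* + 1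
  eq rewrite ℤP.*-identityʳ (+ a) | ℤP.*-identityʳ (+ b) | ℤP.*-identityʳ (+ a ℤ.+ + b) = ℤP.pos-+ a b

fromℕ-homo-* : ∀ a b → fromℕ (a ℕ.* b) ≡ fromℕ a * fromℕ b
fromℕ-homo-* a b = begin
  fromℚᵘ (ℕᵘ (a ℕ.* b))      ≡⟨ ℚP.fromℚᵘ-cong {ℕᵘ (a ℕ.* b)} {ℕᵘ a ℚᵘ.* ℕᵘ b} (ℚᵘ.*≡* eq) ⟩
  fromℚᵘ (ℕᵘ a ℚᵘ.* ℕᵘ b)    ≡⟨ fromℚᵘ-homo-* (ℕᵘ a) (ℕᵘ b) ⟩
  fromℕ a * fromℕ b          ∎
  where
  open ≡-Reasoning
  eq : + (a ℕ.* b) ℤ.* + 1 ≡ (+ a ℤ.* + b) ℤ.* + 1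
  eq rewrite ℤP.*-identityʳ (+ (a ℕ.* b)) | ℤP.*-identityʳ (+ a ℤ.* + b) = ℤP.pos-* a b

1/n*n≡1 : ∀ n .{{_ : NonZero n}} → (+ 1 / n) * fromℕ n ≡ 1ℚ
1/n*n≡1 (suc d) = begin
  fromℚᵘ 1/n * fromℚᵘ (ℕᵘ (suc d))     ≡⟨ fromℚᵘ-homo-* 1/n (ℕᵘ (suc d)) ⟨
  fromℚᵘ (1/n ℚᵘ.* ℕᵘ (suc d))         ≡⟨ ℚP.fromℚᵘ-cong {1/n ℚᵘ.* ℕᵘ (suc d)} {ℕᵘ 1} (ℚᵘ.*≡* eq) ⟩
  1ℚ                                   ∎
  where
  open ≡-Reasoning
  1/n = ℚᵘ.mkℚᵘ (+ 1) d
  eq : (+ 1 ℤ.* + suc d) ℤ.* + 1 ≡ + 1 ℤ.* + (suc d ℕ.* 1)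
  eq rewrite ℤP.*-identityʳ (+ 1 ℤ.* + suc d) | ℕP.*-identityʳ d = refl

invFact*factℚ≡1 : ∀ n → invFact n * factℚ n ≡ 1ℚ
invFact*factℚ≡1 n = 1/n*n≡1 (n !) {{n !≢0}}

factℚ-suc : ∀ n → factℚ (suc n) ≡ fromℕ (suc n) * factℚ n
factℚ-suc n = fromℕ-homo-* (suc n) (n !)

*-inverse-unique : ∀ a b c → a * c ≡ 1ℚ → b * c ≡ 1ℚ → a ≡ b
*-inverse-unique a b c ac≡1 bc≡1 = begin
  a             ≡⟨ ℚP.*-identityʳ a ⟨
  a * 1ℚ        ≡⟨ cong (a *_) bc≡1 ⟨
  a * (b * c)   ≡⟨ solve 3 (λ a b c → a :* (b :* c) := (a :* c) :* b) refl a b c ⟩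
  (a * c) * b   ≡⟨ cong (_* b) ac≡1 ⟩
  1ℚ * b        ≡⟨ ℚP.*-identityˡ b ⟩
  b             ∎
  where open ≡-Reasoning

[1+n]*invFact[1+n]≡invFact[n] : ∀ n → fromℕ (suc n) * invFact (suc n) ≡ invFact n
[1+n]*invFact[1+n]≡invFact[n] n = *-inverse-unique _ _ (factℚ n)
  (begin
    fromℕ (suc n) * invFact (suc n) * factℚ n
      ≡⟨ solve 3 (λ a b c → (a :* b) :* c := b :* (a :* c)) refl (fromℕ (suc n)) (invFact (suc n)) (factℚ n) ⟩
    invFact (suc n) * (fromℕ (suc n) * factℚ n)
      ≡⟨ cong (invFact (suc n) *_) (factℚ-suc n) ⟨
    invFact (suc n) * factℚ (suc n)
      ≡⟨ invFact*factℚ≡1 (suc n) ⟩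
    1ℚ ∎)
  (invFact*factℚ≡1 n)
  where open ≡-Reasoning

n!*invFact[1+n]≡1/[1+n] : ∀ n → factℚ n * invFact (suc n) ≡ + 1 / suc n
n!*invFact[1+n]≡1/[1+n] n = *-inverse-unique _ _ (fromℕ (suc n))
  (begin
    factℚ n * invFact (suc n) * fromℕ (suc n)
      ≡⟨ solve 3 (λ a b c → a :* b :* c := (c :* b) :* a) refl (factℚ n) (invFact (suc n)) (fromℕ (suc n)) ⟩
    fromℕ (suc n) * invFact (suc n) * factℚ n
      ≡⟨ cong (_* factℚ n) ([1+n]*invFact[1+n]≡invFact[n] n) ⟩
    invFact n * factℚ n
      ≡⟨ invFact*factℚ≡1 n ⟩
    1ℚ ∎)
  (1/n*n≡1 (suc n))
  where open ≡-Reasoning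

sgn-suc : ∀ n → sgn (suc n) ≡ - sgn n
sgn-suc n = trans (sym (ℚP.neg-distribˡ-* 1ℚ (sgn n))) (cong -_ (ℚP.*-identityˡ (sgn n)))

sgn-+ : ∀ a b → sgn (a ℕ.+ b) ≡ sgn a * sgn b
sgn-+ zero    b = sym (ℚP.*-identityˡ (sgn b))
sgn-+ (suc a) b = trans (cong (- 1ℚ *_) (sgn-+ a b)) (sym (ℚP.*-assoc (- 1ℚ) (sgn a) (sgn b)))

sumTo-cong-≤ : ∀ n {f g : ℕ → ℚ} → (∀ i → i ℕ.≤ n → f i ≡ g i) → sumTo n f ≡ sumTo n g
sumTo-cong-≤ zero    f≡g = f≡g 0 z≤n
sumTo-cong-≤ (suc n) f≡g = cong₂ _+_ (sumTo-cong-≤ n (λ i i≤n → f≡g i (ℕP.m≤n⇒m≤1+n i≤n))) (f≡g (suc n) ℕP.≤-refl)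

sumTo-cong : ∀ n {f g : ℕ → ℚ} → (∀ i → f i ≡ g i) → sumTo n f ≡ sumTo n g
sumTo-cong n f≡g = sumTo-cong-≤ n (λ i _ → f≡g i)

sumTo-zero : ∀ n {f : ℕ → ℚ} → (∀ i → i ℕ.≤ n → f i ≡ 0ℚ) → sumTo n f ≡ 0ℚ
sumTo-zero zero    f≡0 = f≡0 0 z≤n
sumTo-zero (suc n) f≡0 = cong₂ _+_ (sumTo-zero n (λ i i≤n → f≡0 i (ℕP.m≤n⇒m≤1+n i≤n))) (f≡0 (suc n) ℕP.≤-refl)

sumTo-+ : ∀ n (f g : ℕ → ℚ) → sumTo n (λ i → f i + g i) ≡ sumTo n f + sumTo n g
sumTo-+ zero    f g = refl
sumTo-+ (suc n) f g = begin
  sumTo n (λ i → f i + g i) + (f (suc n) + g (suc n))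
    ≡⟨ cong (_+ (f (suc n) + g (suc n))) (sumTo-+ n f g) ⟩
  (sumTo n f + sumTo n g) + (f (suc n) + g (suc n))
    ≡⟨ solve 4 (λ a b c d → (a :+ b) :+ (c :+ d) := (a :+ c) :+ (b :+ d)) refl (sumTo n f) (sumTo n g) (f (suc n)) (g (suc n)) ⟩
  (sumTo n f + f (suc n)) + (sumTo n g + g (suc n)) ∎
  where open ≡-Reasoning

*-distribˡ-sumTo : ∀ n c (f : ℕ → ℚ) → c * sumTo n f ≡ sumTo n (λ i → c * f i)
*-distribˡ-sumTo zero    c f = refl
*-distribˡ-sumTo (suc n) c f = trans (ℚP.*-distribˡ-+ c (sumTo n f) (f (suc n))) (cong (_+ c * f (suc n)) (*-distribˡ-sumTo n c f))

neg-distrib-sumTo : ∀ n (f : ℕ → ℚ) → - sumTo n f ≡ sumTo n (λ i → - f i)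
neg-distrib-sumTo zero    f = refl
neg-distrib-sumTo (suc n) f = trans (ℚP.neg-distrib-+ (sumTo n f) (f (suc n))) (cong (_+ - f (suc n)) (neg-distrib-sumTo n f))

sumTo-sucˡ : ∀ n (f : ℕ → ℚ) → sumTo (suc n) f ≡ f 0 + sumTo n (f ∘ suc)
sumTo-sucˡ zero    f = refl
sumTo-sucˡ (suc n) f = begin
  sumTo (suc n) f + f (suc (suc n))            ≡⟨ cong (_+ f (suc (suc n))) (sumTo-sucˡ n f) ⟩
  (f 0 + sumTo n (f ∘ suc)) + f (suc (suc n))  ≡⟨ ℚP.+-assoc (f 0) _ _ ⟩
  f 0 + sumTo (suc n) (f ∘ suc)                ∎
  where open ≡-Reasoning

sumTo-reverse : ∀ n (f : ℕ → ℚ) → sumTo n f ≡ sumTo n (λ i → f (n ∸ i))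
sumTo-reverse zero    f = refl
sumTo-reverse (suc n) f = begin
  sumTo n f + f (suc n)                   ≡⟨ cong (_+ f (suc n)) (sumTo-reverse n f) ⟩
  sumTo n (λ i → f (n ∸ i)) + f (suc n)   ≡⟨ ℚP.+-comm _ (f (suc n)) ⟩
  f (suc n) + sumTo n (λ i → f (n ∸ i))   ≡⟨ sumTo-sucˡ n (λ i → f (suc n ∸ i)) ⟨
  sumTo (suc n) (λ i → f (suc n ∸ i))     ∎
  where open ≡-Reasoning

sumTo-extend : ∀ n N (f : ℕ → ℚ) → n ℕ.≤ N → (∀ i → n ℕ.< i → f i ≡ 0ℚ) → sumTo N f ≡ sumTo n f
sumTo-extend n N f n≤N f≡0 = trans (cong (λ N → sumTo N f) (sym (ℕP.m+[n∸m]≡n n≤N))) (go (N ∸ n))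
  where
  go : ∀ d → sumTo (n ℕ.+ d) f ≡ sumTo n f
  go zero    = cong (λ N → sumTo N f) (ℕP.+-identityʳ n)
  go (suc d) = begin
    sumTo (n ℕ.+ suc d) f                  ≡⟨ cong (λ N → sumTo N f) (ℕP.+-suc n d) ⟩
    sumTo (n ℕ.+ d) f + f (suc (n ℕ.+ d))  ≡⟨ cong₂ _+_ (go d) (f≡0 _ (s≤s (ℕP.m≤m+n n d))) ⟩
    sumTo n f + 0ℚ                         ≡⟨ ℚP.+-identityʳ _ ⟩
    sumTo n f                              ∎
    where open ≡-Reasoning

sumTo-trim : ∀ a b (f : ℕ → ℚ) → (∀ i → a ℕ.< i → f i ≡ 0ℚ) → (∀ i → b ℕ.< i → f i ≡ 0ℚ) → sumTo a f ≡ sumTo b f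
sumTo-trim a b f f≡0>a f≡0>b =
  trans (sym (sumTo-extend a (a ℕ.+ b) f (ℕP.m≤m+n a b) f≡0>a)) (sumTo-extend b (a ℕ.+ b) f (ℕP.m≤n+m b a) f≡0>b)

sumTo-swap : ∀ n N (F : ℕ → ℕ → ℚ) → sumTo n (λ i → sumTo N (F i)) ≡ sumTo N (λ s → sumTo n (λ i → F i s))
sumTo-swap zero    N F = refl
sumTo-swap (suc n) N F = trans (cong (_+ sumTo N (F (suc n))) (sumTo-swap n N F)) (sym (sumTo-+ N (λ s → sumTo n (λ i → F i s)) (F (suc n))))

-- Formal power series

infix  4 _≐_
infixl 6 _⊕_ _⊖_
infixr 7 _·_

_≐_ : Series → Series → Set
f ≐ g = ∀ n → f n ≡ g n

≐-refl : ∀ {f} → f ≐ f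
≐-refl n = refl

≐-sym : ∀ {f g} → f ≐ g → g ≐ f
≐-sym f≐g n = sym (f≐g n)

≐-trans : ∀ {f g h} → f ≐ g → g ≐ h → f ≐ h
≐-trans f≐g g≐h n = trans (f≐g n) (g≐h n)

≐-isEquivalence : IsEquivalence _≐_
≐-isEquivalence = record { refl = ≐-refl ; sym = ≐-sym ; trans = ≐-trans }

≐-setoid : Setoid 0ℓ 0ℓ
≐-setoid = record { isEquivalence = ≐-isEquivalence }

module ≐-Reasoning = SetoidReasoning ≐-setoid

𝟘 : Series
𝟘 n = 0ℚ

𝟙 : Series
𝟙 zero    = 1ℚ
𝟙 (suc n) = 0ℚ

_⊕_ : Series → Series → Series
(f ⊕ g) n = f n + g n

⊝ : Series → Series
⊝ f n = - f n

_⊖_ : Series → Series → Series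
f ⊖ g = f ⊕ ⊝ g

_·_ : ℚ → Series → Series
(c · f) n = c * f n

⊕-cong : ∀ {f f′ g g′} → f ≐ f′ → g ≐ g′ → f ⊕ g ≐ f′ ⊕ g′
⊕-cong f≐f′ g≐g′ n = cong₂ _+_ (f≐f′ n) (g≐g′ n)

⊕-congʳ : ∀ f {g g′} → g ≐ g′ → f ⊕ g ≐ f ⊕ g′
⊕-congʳ f = ⊕-cong (≐-refl {f})

·-congʳ : ∀ c {f g} → f ≐ g → c · f ≐ c · g
·-congʳ c f≐g n = cong (c *_) (f≐g n)

⊛-suc : ∀ (f g : Series) n → (f ⊛ g) (suc n) ≡ f 0 * g (suc n) + ((f ∘ suc) ⊛ g) n
⊛-suc f g n = sumTo-sucˡ n (λ i → f i * g (suc n ∸ i))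

⊛-cong : ∀ {f f′ g g′} → f ≐ f′ → g ≐ g′ → f ⊛ g ≐ f′ ⊛ g′
⊛-cong f≐f′ g≐g′ n = sumTo-cong n (λ i → cong₂ _*_ (f≐f′ i) (g≐g′ (n ∸ i)))

⊛-congˡ : ∀ {f f′} g → f ≐ f′ → f ⊛ g ≐ f′ ⊛ g
⊛-congˡ g f≐f′ = ⊛-cong f≐f′ (≐-refl {g})

⊛-congʳ : ∀ f {g g′} → g ≐ g′ → f ⊛ g ≐ f ⊛ g′
⊛-congʳ f g≐g′ = ⊛-cong (≐-refl {f}) g≐g′

⊛-comm : ∀ f g → f ⊛ g ≐ g ⊛ f
⊛-comm f g n = trans (sumTo-reverse n (λ i → f i * g (n ∸ i)))
  (sumTo-cong-≤ n (λ i i≤n → trans (cong (λ k → f (n ∸ i) * g k) (ℕP.m∸[m∸n]≡n i≤n)) (ℚP.*-comm (f (n ∸ i)) (g i))))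

⊛-distribˡ : ∀ f g h → f ⊛ (g ⊕ h) ≐ f ⊛ g ⊕ f ⊛ h
⊛-distribˡ f g h n = trans (sumTo-cong n (λ i → ℚP.*-distribˡ-+ (f i) (g (n ∸ i)) (h (n ∸ i)))) (sumTo-+ n _ _)

⊛-distribʳ : ∀ f g h → (g ⊕ h) ⊛ f ≐ g ⊛ f ⊕ h ⊛ f
⊛-distribʳ f g h n = begin
  ((g ⊕ h) ⊛ f) n          ≡⟨ ⊛-comm (g ⊕ h) f n ⟩
  (f ⊛ (g ⊕ h)) n          ≡⟨ ⊛-distribˡ f g h n ⟩
  (f ⊛ g) n + (f ⊛ h) n    ≡⟨ cong₂ _+_ (⊛-comm f g n) (⊛-comm f h n) ⟩
  (g ⊛ f) n + (h ⊛ f) n    ∎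
  where open ≡-Reasoning

⊛-·ˡ : ∀ c f g → (c · f) ⊛ g ≐ c · (f ⊛ g)
⊛-·ˡ c f g n = trans (sumTo-cong n (λ i → ℚP.*-assoc c (f i) (g (n ∸ i)))) (sym (*-distribˡ-sumTo n c _))

⊛-·ʳ : ∀ c f g → f ⊛ (c · g) ≐ c · (f ⊛ g)
⊛-·ʳ c f g n = trans (⊛-comm f (c · g) n) (trans (⊛-·ˡ c g f n) (cong (c *_) (⊛-comm g f n)))

⊛-zeroˡ : ∀ f → 𝟘 ⊛ f ≐ 𝟘
⊛-zeroˡ f n = sumTo-zero n (λ i _ → ℚP.*-zeroˡ (f (n ∸ i)))

⊛-identityˡ : ∀ f → 𝟙 ⊛ f ≐ f
⊛-identityˡ f zero    = ℚP.*-identityˡ (f 0)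
⊛-identityˡ f (suc n) = begin
  (𝟙 ⊛ f) (suc n)               ≡⟨ ⊛-suc 𝟙 f n ⟩
  1ℚ * f (suc n) + (𝟘 ⊛ f) n    ≡⟨ cong₂ _+_ (ℚP.*-identityˡ (f (suc n))) (⊛-zeroˡ f n) ⟩
  f (suc n) + 0ℚ                ≡⟨ ℚP.+-identityʳ (f (suc n)) ⟩
  f (suc n)                     ∎
  where open ≡-Reasoning

⊛-identityʳ : ∀ f → f ⊛ 𝟙 ≐ f
⊛-identityʳ f = ≐-trans (⊛-comm f 𝟙) (⊛-identityˡ f)

⊛-assoc : ∀ f g h → (f ⊛ g) ⊛ h ≐ f ⊛ (g ⊛ h)
⊛-assoc f g h zero    = ℚP.*-assoc (f 0) (g 0) (h 0)
⊛-assoc f g h (suc n) = begin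
  ((f ⊛ g) ⊛ h) (suc n)
    ≡⟨ ⊛-suc (f ⊛ g) h n ⟩
  f 0 * g 0 * h (suc n) + (((f ⊛ g) ∘ suc) ⊛ h) n
    ≡⟨ cong (λ z → f 0 * g 0 * h (suc n) + z) (⊛-congˡ h (⊛-suc f g) n) ⟩
  f 0 * g 0 * h (suc n) + ((f 0 · (g ∘ suc) ⊕ (f ∘ suc) ⊛ g) ⊛ h) n
    ≡⟨ cong (λ z → f 0 * g 0 * h (suc n) + z) (⊛-distribʳ h (f 0 · (g ∘ suc)) ((f ∘ suc) ⊛ g) n) ⟩
  f 0 * g 0 * h (suc n) + (((f 0 · (g ∘ suc)) ⊛ h) n + (((f ∘ suc) ⊛ g) ⊛ h) n)
    ≡⟨ cong₂ (λ a b → f 0 * g 0 * h (suc n) + (a + b)) (⊛-·ˡ (f 0) (g ∘ suc) h n) (⊛-assoc (f ∘ suc) g h n) ⟩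
  f 0 * g 0 * h (suc n) + (f 0 * ((g ∘ suc) ⊛ h) n + ((f ∘ suc) ⊛ (g ⊛ h)) n)
    ≡⟨ solve 5 (λ a b c d e → a :* b :* c :+ (a :* d :+ e) := a :* (b :* c :+ d) :+ e) refl
         (f 0) (g 0) (h (suc n)) (((g ∘ suc) ⊛ h) n) (((f ∘ suc) ⊛ (g ⊛ h)) n) ⟩
  f 0 * (g 0 * h (suc n) + ((g ∘ suc) ⊛ h) n) + ((f ∘ suc) ⊛ (g ⊛ h)) n
    ≡⟨ cong (λ a → f 0 * a + ((f ∘ suc) ⊛ (g ⊛ h)) n) (⊛-suc g h n) ⟨
  f 0 * (g ⊛ h) (suc n) + ((f ∘ suc) ⊛ (g ⊛ h)) n
    ≡⟨ ⊛-suc f (g ⊛ h) n ⟨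
  (f ⊛ (g ⊛ h)) (suc n) ∎
  where open ≡-Reasoning

⊕-⊛-commutativeRing : CommutativeRing 0ℓ 0ℓ
⊕-⊛-commutativeRing = record
  { Carrier = Series ; _≈_ = _≐_ ; _+_ = _⊕_ ; _*_ = _⊛_ ; -_ = ⊝ ; 0# = 𝟘 ; 1# = 𝟙
  ; isCommutativeRing = record
    { isRing = record
      { +-isAbelianGroup = record
        { isGroup = record
          { isMonoid = record
            { isSemigroup = record
              { isMagma = record { isEquivalence = ≐-isEquivalence ; ∙-cong = ⊕-cong }
              ; assoc = λ f g h n → ℚP.+-assoc (f n) (g n) (h n) }
            ; identity = (λ f n → ℚP.+-identityˡ (f n)) , (λ f n → ℚP.+-identityʳ (f n)) }
          ; inverse = (λ f n → ℚP.+-inverseˡ (f n)) , (λ f n → ℚP.+-inverseʳ (f n))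
          ; ⁻¹-cong = λ f≐g n → cong -_ (f≐g n) }
        ; comm = λ f g n → ℚP.+-comm (f n) (g n) }
      ; *-cong = ⊛-cong
      ; *-assoc = ⊛-assoc
      ; *-identity = ⊛-identityˡ , ⊛-identityʳ
      ; distrib = ⊛-distribˡ , ⊛-distribʳ }
    ; *-comm = ⊛-comm } }

import Algebra.Properties.CommutativeSemiring.Binomial (CommutativeRing.commutativeSemiring ⊕-⊛-commutativeRing) as Binomial
open import Algebra.Definitions.RawMonoid (CommutativeRing.+-rawMonoid ⊕-⊛-commutativeRing) using (_×_; sum)
open import Algebra.Properties.Semiring.Exp (CommutativeRing.semiring ⊕-⊛-commutativeRing) using (_^_)
open CommutativeRing ⊕-⊛-commutativeRing using (-‿cong; -‿inverseʳ; +-group)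
open import Algebra.Properties.Group +-group using (inverseʳ-unique)
open import Algebra.Properties.Ring (CommutativeRing.ring ⊕-⊛-commutativeRing) using (-‿distribʳ-*; [y-z]x≈yx-zx)
open import Algebra.Properties.CommutativeSemigroup (CommutativeRing.*-commutativeSemigroup ⊕-⊛-commutativeRing)
  using (interchange; x∙yz≈y∙xz; xy∙z≈xz∙y)

-- θ is the Euler operator x d/dx, and σ f is f(−x).
θ : Series → Series
θ f n = fromℕ n * f n

σ : Series → Series
σ f n = sgn n * f n

mulX : Series → Series
mulX f zero    = 0ℚ
mulX f (suc n) = f n

θ-cong : ∀ {f g} → f ≐ g → θ f ≐ θ g
θ-cong f≐g n = cong (fromℕ n *_) (f≐g n)

θ-𝟙 : θ 𝟙 ≐ 𝟘
θ-𝟙 zero    = refl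
θ-𝟙 (suc n) = ℚP.*-zeroʳ (fromℕ (suc n))

θ-· : ∀ c f → θ (c · f) ≐ c · θ f
θ-· c f n = solve 3 (λ a b d → a :* (b :* d) := b :* (a :* d)) refl (fromℕ n) c (f n)

θ-⊖𝟙 : ∀ f → θ (f ⊖ 𝟙) ≐ θ f
θ-⊖𝟙 f n = begin
  fromℕ n * (f n + - 𝟙 n)               ≡⟨ ℚP.*-distribˡ-+ (fromℕ n) (f n) (- 𝟙 n) ⟩
  fromℕ n * f n + fromℕ n * - 𝟙 n       ≡⟨ cong (λ z → fromℕ n * f n + z) (ℚP.neg-distribʳ-* (fromℕ n) (𝟙 n)) ⟨
  fromℕ n * f n + - (fromℕ n * 𝟙 n)     ≡⟨ cong (λ z → fromℕ n * f n + - z) (θ-𝟙 n) ⟩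
  fromℕ n * f n + 0ℚ                    ≡⟨ ℚP.+-identityʳ (fromℕ n * f n) ⟩
  fromℕ n * f n                         ∎
  where open ≡-Reasoning

θ-leibniz : ∀ f g → θ (f ⊛ g) ≐ θ f ⊛ g ⊕ f ⊛ θ g
θ-leibniz f g n = trans (*-distribˡ-sumTo n (fromℕ n) _) (trans (sumTo-cong-≤ n termwise) (sumTo-+ n _ _))
  where
  termwise : ∀ i → i ℕ.≤ n → fromℕ n * (f i * g (n ∸ i)) ≡ fromℕ i * f i * g (n ∸ i) + f i * (fromℕ (n ∸ i) * g (n ∸ i))
  termwise i i≤n = begin
    fromℕ n * (f i * g (n ∸ i))                 ≡⟨ cong (λ k → fromℕ k * (f i * g (n ∸ i))) (ℕP.m+[n∸m]≡n i≤n) ⟨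
    fromℕ (i ℕ.+ (n ∸ i)) * (f i * g (n ∸ i))   ≡⟨ cong (_* (f i * g (n ∸ i))) (fromℕ-homo-+ i (n ∸ i)) ⟩
    (fromℕ i + fromℕ (n ∸ i)) * (f i * g (n ∸ i))
      ≡⟨ solve 4 (λ a b c d → (a :+ b) :* (c :* d) := a :* c :* d :+ c :* (b :* d)) refl (fromℕ i) (fromℕ (n ∸ i)) (f i) (g (n ∸ i)) ⟩
    fromℕ i * f i * g (n ∸ i) + f i * (fromℕ (n ∸ i) * g (n ∸ i)) ∎
    where open ≡-Reasoning

θ-^ : ∀ f n → θ (f ^ suc n) ≐ fromℕ (suc n) · (θ f ⊛ (f ^ n))
θ-^ f zero = begin
  θ (f ⊛ 𝟙)                   ≈⟨ θ-cong (⊛-identityʳ f) ⟩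
  θ f                         ≈⟨ (λ k → sym (ℚP.*-identityˡ (θ f k))) ⟩
  fromℕ 1 · θ f               ≈⟨ ·-congʳ (fromℕ 1) (⊛-identityʳ (θ f)) ⟨
  fromℕ 1 · (θ f ⊛ 𝟙)         ∎
  where open ≐-Reasoning
θ-^ f (suc n) = begin
  θ (f ⊛ (f ^ suc n))
    ≈⟨ θ-leibniz f (f ^ suc n) ⟩
  θ f ⊛ (f ^ suc n) ⊕ f ⊛ θ (f ^ suc n)
    ≈⟨ ⊕-congʳ (θ f ⊛ (f ^ suc n)) (⊛-congʳ f (θ-^ f n)) ⟩
  θ f ⊛ (f ^ suc n) ⊕ f ⊛ (fromℕ (suc n) · (θ f ⊛ (f ^ n)))
    ≈⟨ ⊕-congʳ (θ f ⊛ (f ^ suc n)) (⊛-·ʳ (fromℕ (suc n)) f (θ f ⊛ (f ^ n))) ⟩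
  θ f ⊛ (f ^ suc n) ⊕ fromℕ (suc n) · (f ⊛ (θ f ⊛ (f ^ n)))
    ≈⟨ ⊕-congʳ (θ f ⊛ (f ^ suc n)) (·-congʳ (fromℕ (suc n)) (x∙yz≈y∙xz f (θ f) (f ^ n))) ⟩
  θ f ⊛ (f ^ suc n) ⊕ fromℕ (suc n) · (θ f ⊛ (f ^ suc n))
    ≈⟨ 1+n·h (θ f ⊛ (f ^ suc n)) ⟩
  fromℕ (suc (suc n)) · (θ f ⊛ (f ^ suc n)) ∎
  where
  open ≐-Reasoning
  1+n·h : ∀ h → h ⊕ fromℕ (suc n) · h ≐ fromℕ (suc (suc n)) · h
  1+n·h h k = trans (solve 2 (λ a b → a :+ b :* a := (con 1ℚ :+ b) :* a) refl (h k) (fromℕ (suc n)))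
                    (cong (_* h k) (sym (fromℕ-homo-+ 1 (suc n))))

θ-coeff-suc : ∀ f k → f (suc k) ≡ (+ 1 / suc k) * θ f (suc k)
θ-coeff-suc f k = begin
  f (suc k)                                      ≡⟨ ℚP.*-identityˡ (f (suc k)) ⟨
  1ℚ * f (suc k)                                 ≡⟨ cong (_* f (suc k)) (1/n*n≡1 (suc k)) ⟨
  (+ 1 / suc k) * fromℕ (suc k) * f (suc k)      ≡⟨ ℚP.*-assoc (+ 1 / suc k) (fromℕ (suc k)) (f (suc k)) ⟩
  (+ 1 / suc k) * θ f (suc k)                    ∎
  where open ≡-Reasoning

θ-kernel : ∀ h → θ h ≐ 𝟘 → ∀ k → h (suc k) ≡ 0ℚ
θ-kernel h θh≐𝟘 k = begin
  h (suc k)                        ≡⟨ θ-coeff-suc h k ⟩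
  (+ 1 / suc k) * θ h (suc k)      ≡⟨ cong ((+ 1 / suc k) *_) (θh≐𝟘 (suc k)) ⟩
  (+ 1 / suc k) * 0ℚ               ≡⟨ ℚP.*-zeroʳ (+ 1 / suc k) ⟩
  0ℚ                               ∎
  where open ≡-Reasoning

σ-cong : ∀ {f g} → f ≐ g → σ f ≐ σ g
σ-cong f≐g n = cong (sgn n *_) (f≐g n)

σ-𝟙 : σ 𝟙 ≐ 𝟙
σ-𝟙 zero    = refl
σ-𝟙 (suc n) = ℚP.*-zeroʳ (sgn (suc n))

σ-⊛ : ∀ f g → σ (f ⊛ g) ≐ σ f ⊛ σ g
σ-⊛ f g n = trans (*-distribˡ-sumTo n (sgn n) _) (sumTo-cong-≤ n termwise)
  where
  termwise : ∀ i → i ℕ.≤ n → sgn n * (f i * g (n ∸ i)) ≡ sgn i * f i * (sgn (n ∸ i) * g (n ∸ i))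
  termwise i i≤n = begin
    sgn n * (f i * g (n ∸ i))                   ≡⟨ cong (λ k → sgn k * (f i * g (n ∸ i))) (ℕP.m+[n∸m]≡n i≤n) ⟨
    sgn (i ℕ.+ (n ∸ i)) * (f i * g (n ∸ i))     ≡⟨ cong (_* (f i * g (n ∸ i))) (sgn-+ i (n ∸ i)) ⟩
    sgn i * sgn (n ∸ i) * (f i * g (n ∸ i))
      ≡⟨ solve 4 (λ a b c d → (a :* b) :* (c :* d) := a :* c :* (b :* d)) refl (sgn i) (sgn (n ∸ i)) (f i) (g (n ∸ i)) ⟩
    sgn i * f i * (sgn (n ∸ i) * g (n ∸ i))     ∎
    where open ≡-Reasoning

mulX-cong : ∀ {f g} → f ≐ g → mulX f ≐ mulX g
mulX-cong f≐g zero    = refl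
mulX-cong f≐g (suc n) = f≐g n

mulX-⊛ : ∀ f g → mulX f ⊛ g ≐ mulX (f ⊛ g)
mulX-⊛ f g zero    = ℚP.*-zeroˡ (g 0)
mulX-⊛ f g (suc n) = begin
  (mulX f ⊛ g) (suc n)            ≡⟨ ⊛-suc (mulX f) g n ⟩
  0ℚ * g (suc n) + (f ⊛ g) n      ≡⟨ cong (_+ (f ⊛ g) n) (ℚP.*-zeroˡ (g (suc n))) ⟩
  0ℚ + (f ⊛ g) n                  ≡⟨ ℚP.+-identityˡ ((f ⊛ g) n) ⟩
  (f ⊛ g) n                       ∎
  where open ≡-Reasoning

VanishesBelow : ℕ → Series → Set
VanishesBelow j f = ∀ i → i ℕ.< j → f i ≡ 0ℚ

⊛-vanishesBelow : ∀ a b {f g} → VanishesBelow a f → VanishesBelow b g → VanishesBelow (a ℕ.+ b) (f ⊛ g)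
⊛-vanishesBelow a b {f} {g} f<a g<b n n<a+b = sumTo-zero n termwise
  where
  termwise : ∀ i → i ℕ.≤ n → f i * g (n ∸ i) ≡ 0ℚ
  termwise i i≤n with i ℕ.<? a
  ... | yes i<a = trans (cong (_* g (n ∸ i)) (f<a i i<a)) (ℚP.*-zeroˡ (g (n ∸ i)))
  ... | no  i≮a = trans (cong (f i *_) (g<b (n ∸ i) n∸i<b)) (ℚP.*-zeroʳ (f i))
    where
    a≤i = ℕP.≮⇒≥ i≮a
    n∸i<b : n ∸ i ℕ.< b
    n∸i<b = ℕP.≤-<-trans (ℕP.∸-monoʳ-≤ n a≤i)
              (subst (n ∸ a ℕ.<_) (ℕP.m+n∸m≡n a b) (ℕP.∸-monoˡ-< n<a+b (ℕP.≤-trans a≤i i≤n)))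

^-vanishesBelow : ∀ s {f} → VanishesBelow 1 f → VanishesBelow s (f ^ s)
^-vanishesBelow zero    f<1 i ()
^-vanishesBelow (suc s) f<1 = ⊛-vanishesBelow 1 s f<1 (^-vanishesBelow s f<1)

AgreeUpTo : ℕ → Series → Series → Set
AgreeUpTo N f g = ∀ i → i ℕ.≤ N → f i ≡ g i

⊛-agreeUpTo : ∀ N {f f′ g g′} → AgreeUpTo N f f′ → AgreeUpTo N g g′ → AgreeUpTo N (f ⊛ g) (f′ ⊛ g′)
⊛-agreeUpTo N f≈f′ g≈g′ n n≤N = sumTo-cong-≤ n (λ i i≤n →
  cong₂ _*_ (f≈f′ i (ℕP.≤-trans i≤n n≤N)) (g≈g′ (n ∸ i) (ℕP.≤-trans (ℕP.m∸n≤m n i) n≤N)))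

^-agreeUpTo : ∀ N s {f g} → AgreeUpTo N f g → AgreeUpTo N (f ^ s) (g ^ s)
^-agreeUpTo N zero    f≈g i i≤N = refl
^-agreeUpTo N (suc s) f≈g = ⊛-agreeUpTo N f≈g (^-agreeUpTo N s f≈g)

-- The logarithm

sumˢ : ℕ → (ℕ → Series) → Series
sumˢ N F n = sumTo N (λ s → F s n)

sumˢ-cong : ∀ N {F G} → (∀ s → F s ≐ G s) → sumˢ N F ≐ sumˢ N G
sumˢ-cong N F≐G n = sumTo-cong N (λ s → F≐G s n)

⊛-distribˡ-sumˢ : ∀ f N F → f ⊛ sumˢ N F ≐ sumˢ N (λ s → f ⊛ F s)
⊛-distribˡ-sumˢ f N F n =
  trans (sumTo-cong n (λ i → *-distribˡ-sumTo N (f i) (λ s → F s (n ∸ i)))) (sumTo-swap n N (λ i s → f i * F s (n ∸ i)))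

θ-sumˢ : ∀ N F → θ (sumˢ N F) ≐ sumˢ N (θ ∘ F)
θ-sumˢ N F n = *-distribˡ-sumTo N (fromℕ n) (λ s → F s n)

alternating-telescope : ∀ (v : ℕ → ℚ) N →
  sumTo N (λ s → sgn s * v s) + sumTo N (λ s → sgn s * v (suc s)) ≡ v 0 + sgn N * v (suc N)
alternating-telescope v zero = solve 2 (λ a b → con 1ℚ :* a :+ con 1ℚ :* b := a :+ con 1ℚ :* b) refl (v 0) (v 1)
alternating-telescope v (suc N) = begin
  (A + sgn (suc N) * v (suc N)) + (B + sgn (suc N) * v (suc (suc N)))
    ≡⟨ solve 5 (λ a b c d e → (a :+ c :* d) :+ (b :+ c :* e) := (a :+ b) :+ c :* d :+ c :* e) refl
         A B (sgn (suc N)) (v (suc N)) (v (suc (suc N))) ⟩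
  (A + B) + sgn (suc N) * v (suc N) + sgn (suc N) * v (suc (suc N))
    ≡⟨ cong₂ (λ z e → z + e * v (suc N) + e * v (suc (suc N))) (alternating-telescope v N) (sgn-suc N) ⟩
  (v 0 + sgn N * v (suc N)) + (- sgn N) * v (suc N) + (- sgn N) * v (suc (suc N))
    ≡⟨ solve 4 (λ a b c d → (a :+ b :* c) :+ (:- b) :* c :+ (:- b) :* d := a :+ (:- b) :* d) refl
         (v 0) (sgn N) (v (suc N)) (v (suc (suc N))) ⟩
  v 0 + (- sgn N) * v (suc (suc N))
    ≡⟨ cong (λ e → v 0 + e * v (suc (suc N))) (sgn-suc N) ⟨
  v 0 + sgn (suc N) * v (suc (suc N)) ∎
  where
  open ≡-Reasoning
  A = sumTo N (λ s → sgn s * v s)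
  B = sumTo N (λ s → sgn s * v (suc s))

-- Partial sums of log (1 + g).  When g 0 = 0 the terms with s ≥ n start above xⁿ, so log1p g is log (1 + g).
logTrunc : Series → ℕ → Series
logTrunc g N = sumˢ N (λ s → (sgn s * (+ 1 / suc s)) · (g ^ suc s))

log1p : Series → Series
log1p g n = logTrunc g n n

module _ (g : Series) where

  θ-logTrunc : ∀ N → θ (logTrunc g N) ≐ sumˢ N (λ s → sgn s · (θ g ⊛ (g ^ s)))
  θ-logTrunc N = ≐-trans (θ-sumˢ N _) (sumˢ-cong N termwise)
    where
    termwise : ∀ s → θ ((sgn s * (+ 1 / suc s)) · (g ^ suc s)) ≐ sgn s · (θ g ⊛ (g ^ s))
    termwise s n = begin
      θ ((sgn s * (+ 1 / suc s)) · (g ^ suc s)) n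
        ≡⟨ θ-· (sgn s * (+ 1 / suc s)) (g ^ suc s) n ⟩
      sgn s * (+ 1 / suc s) * θ (g ^ suc s) n
        ≡⟨ cong (sgn s * (+ 1 / suc s) *_) (θ-^ g s n) ⟩
      sgn s * (+ 1 / suc s) * (fromℕ (suc s) * (θ g ⊛ (g ^ s)) n)
        ≡⟨ solve 4 (λ a b c d → (a :* b) :* (c :* d) := a :* ((b :* c) :* d)) refl (sgn s) (+ 1 / suc s) (fromℕ (suc s)) ((θ g ⊛ (g ^ s)) n) ⟩
      sgn s * ((+ 1 / suc s) * fromℕ (suc s) * (θ g ⊛ (g ^ s)) n)
        ≡⟨ cong (λ z → sgn s * (z * (θ g ⊛ (g ^ s)) n)) (1/n*n≡1 (suc s)) ⟩
      sgn s * (1ℚ * (θ g ⊛ (g ^ s)) n)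
        ≡⟨ cong (sgn s *_) (ℚP.*-identityˡ _) ⟩
      sgn s * (θ g ⊛ (g ^ s)) n ∎
      where open ≡-Reasoning

  1+g⊛θlogTrunc : ∀ N → (𝟙 ⊕ g) ⊛ θ (logTrunc g N) ≐ θ g ⊕ sgn N · (θ g ⊛ (g ^ suc N))
  1+g⊛θlogTrunc N n = begin
    ((𝟙 ⊕ g) ⊛ θ (logTrunc g N)) n
      ≡⟨ ⊛-congʳ (𝟙 ⊕ g) (θ-logTrunc N) n ⟩
    ((𝟙 ⊕ g) ⊛ sumˢ N U) n
      ≡⟨ ⊛-distribʳ (sumˢ N U) 𝟙 g n ⟩
    (𝟙 ⊛ sumˢ N U) n + (g ⊛ sumˢ N U) n
      ≡⟨ cong₂ _+_ (⊛-identityˡ (sumˢ N U) n) (trans (⊛-distribˡ-sumˢ g N U n) (sumˢ-cong N g⊛U n)) ⟩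
    sumTo N (λ s → sgn s * u s n) + sumTo N (λ s → sgn s * u (suc s) n)
      ≡⟨ alternating-telescope (λ s → u s n) N ⟩
    u 0 n + sgn N * u (suc N) n
      ≡⟨ cong (_+ sgn N * u (suc N) n) (⊛-identityʳ (θ g) n) ⟩
    θ g n + sgn N * u (suc N) n ∎
    where
    open ≡-Reasoning
    u : ℕ → Series
    u s = θ g ⊛ (g ^ s)
    U : ℕ → Series
    U s = sgn s · u s
    g⊛U : ∀ s → g ⊛ U s ≐ sgn s · u (suc s)
    g⊛U s = ≐-trans (⊛-·ʳ (sgn s) g (u s)) (·-congʳ (sgn s) (x∙yz≈y∙xz g (θ g) (g ^ s)))

  module _ (g<1 : VanishesBelow 1 g) where

    logTrunc-stable : ∀ {N M} i → i ℕ.≤ suc N → N ℕ.≤ M → logTrunc g M i ≡ logTrunc g N i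
    logTrunc-stable {N} {M} i i≤1+N N≤M = sumTo-extend N M _ N≤M (λ s N<s →
      trans (cong (sgn s * (+ 1 / suc s) *_) (^-vanishesBelow (suc s) g<1 i (ℕP.≤-<-trans i≤1+N (s≤s N<s))))
            (ℚP.*-zeroʳ (sgn s * (+ 1 / suc s))))

    θ-log1p : (𝟙 ⊕ g) ⊛ θ (log1p g) ≐ θ g
    θ-log1p k = begin
      ((𝟙 ⊕ g) ⊛ θ (log1p g)) k
        ≡⟨ ⊛-agreeUpTo k {𝟙 ⊕ g} (λ i _ → refl)
             (λ i i≤k → cong (fromℕ i *_) (sym (logTrunc-stable i (ℕP.m≤n⇒m≤1+n ℕP.≤-refl) i≤k))) k ℕP.≤-refl ⟩
      ((𝟙 ⊕ g) ⊛ θ (logTrunc g k)) k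
        ≡⟨ 1+g⊛θlogTrunc k k ⟩
      θ g k + sgn k * (θ g ⊛ (g ^ suc k)) k
        ≡⟨ cong (λ z → θ g k + sgn k * z) (⊛-vanishesBelow 0 (suc k) {θ g} (λ _ ()) (^-vanishesBelow (suc k) g<1) k ℕP.≤-refl) ⟩
      θ g k + sgn k * 0ℚ
        ≡⟨ cong (λ z → θ g k + z) (ℚP.*-zeroʳ (sgn k)) ⟩
      θ g k + 0ℚ
        ≡⟨ ℚP.+-identityʳ (θ g k) ⟩
      θ g k ∎
      where open ≡-Reasoning

⊖𝟙-vanishesBelow : ∀ a → a 0 ≡ 1ℚ → VanishesBelow 1 (a ⊖ 𝟙)
⊖𝟙-vanishesBelow a a₀≡1 zero    _ = cong (_+ - 1ℚ) a₀≡1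
⊖𝟙-vanishesBelow a a₀≡1 (suc i) (s≤s ())

θ-log : ∀ a b h → a 0 ≡ 1ℚ → b ⊛ a ≐ 𝟙 → θ a ≐ a ⊛ h → θ (log1p (a ⊖ 𝟙)) ≐ h
θ-log a b h a₀≡1 b⊛a≐𝟙 θa≐a⊛h = begin
  θ ℓ                    ≈⟨ ⊛-identityˡ (θ ℓ) ⟨
  𝟙 ⊛ θ ℓ                ≈⟨ ⊛-congˡ (θ ℓ) b⊛a≐𝟙 ⟨
  (b ⊛ a) ⊛ θ ℓ          ≈⟨ ⊛-assoc b a (θ ℓ) ⟩
  b ⊛ (a ⊛ θ ℓ)          ≈⟨ ⊛-congʳ b (⊛-congˡ (θ ℓ) 1+g≐a) ⟨
  b ⊛ ((𝟙 ⊕ g) ⊛ θ ℓ)    ≈⟨ ⊛-congʳ b (θ-log1p g (⊖𝟙-vanishesBelow a a₀≡1)) ⟩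
  b ⊛ θ g                ≈⟨ ⊛-congʳ b (≐-trans (θ-⊖𝟙 a) θa≐a⊛h) ⟩
  b ⊛ (a ⊛ h)            ≈⟨ ⊛-assoc b a h ⟨
  (b ⊛ a) ⊛ h            ≈⟨ ⊛-congˡ h b⊛a≐𝟙 ⟩
  𝟙 ⊛ h                  ≈⟨ ⊛-identityˡ h ⟩
  h                      ∎
  where
  open ≐-Reasoning
  g = a ⊖ 𝟙
  ℓ = log1p g
  1+g≐a : 𝟙 ⊕ g ≐ a
  1+g≐a n = solve 2 (λ x y → y :+ (x :+ :- y) := x) refl (a n) (𝟙 n)

-- The series x/(eˣ − 1)

nth-++ˡ : ∀ (xs ys : List ℚ) i → i ℕ.< length xs → nth (xs ++ ys) i ≡ nth xs i
nth-++ˡ (x ∷ xs) ys zero    _         = refl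
nth-++ˡ (x ∷ xs) ys (suc i) (s≤s i<n) = nth-++ˡ xs ys i i<n

nth-++-length : ∀ (xs : List ℚ) y → nth (xs ++ [ y ]) (length xs) ≡ y
nth-++-length []       y = refl
nth-++-length (x ∷ xs) y = nth-++-length xs y

length-tdCoeffs : ∀ n → length (tdCoeffs n) ≡ suc n
length-tdCoeffs zero    = refl
length-tdCoeffs (suc n) = trans (length-++ (tdCoeffs n)) (trans (cong (ℕ._+ 1) (length-tdCoeffs n)) (ℕP.+-comm (suc n) 1))

nth-tdCoeffs : ∀ n i → i ℕ.≤ n → nth (tdCoeffs n) i ≡ todd i
nth-tdCoeffs zero    zero _ = refl
nth-tdCoeffs (suc n) i i≤1+n with ℕP.m≤n⇒m<n∨m≡n i≤1+n
... | inj₂ refl        = refl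
... | inj₁ (s≤s i≤n) = trans (nth-++ˡ (tdCoeffs n) _ i (subst (i ℕ.<_) (sym (length-tdCoeffs n)) (s≤s i≤n))) (nth-tdCoeffs n i i≤n)

todd-suc : ∀ n → todd (suc n) ≡ - sumTo n (λ i → expm1Over (suc i) * todd (n ∸ i))
todd-suc n = begin
  nth (tdCoeffs n ++ [ last ]) (suc n)            ≡⟨ cong (nth (tdCoeffs n ++ [ last ])) (length-tdCoeffs n) ⟨
  nth (tdCoeffs n ++ [ last ]) (length (tdCoeffs n)) ≡⟨ nth-++-length (tdCoeffs n) last ⟩
  last
    ≡⟨ cong -_ (sumTo-cong-≤ n (λ i _ → cong (expm1Over (suc i) *_) (nth-tdCoeffs n (n ∸ i) (ℕP.m∸n≤m n i)))) ⟩
  - sumTo n (λ i → expm1Over (suc i) * todd (n ∸ i)) ∎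
  where
  open ≡-Reasoning
  last = - sumTo n (λ i → expm1Over (suc i) * nth (tdCoeffs n) (n ∸ i))

expm1Over⊛todd : expm1Over ⊛ todd ≐ 𝟙
expm1Over⊛todd zero    = refl
expm1Over⊛todd (suc n) = begin
  (expm1Over ⊛ todd) (suc n)         ≡⟨ ⊛-suc expm1Over todd n ⟩
  1ℚ * todd (suc n) + S              ≡⟨ cong (_+ S) (trans (ℚP.*-identityˡ (todd (suc n))) (todd-suc n)) ⟩
  - S + S                            ≡⟨ ℚP.+-inverseˡ S ⟩
  0ℚ                                 ∎
  where
  open ≡-Reasoning
  S = sumTo n (λ i → expm1Over (suc i) * todd (n ∸ i))

exp : Series
exp = invFact

θ-exp : θ exp ≐ mulX exp
θ-exp zero    = ℚP.*-zeroˡ (exp 0)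
θ-exp (suc n) = [1+n]*invFact[1+n]≡invFact[n] n

θ-expm1Over : θ expm1Over ≐ exp ⊖ expm1Over
θ-expm1Over n = begin
  fromℕ n * invFact (suc n)
    ≡⟨ solve 2 (λ a b → a :* b := (con 1ℚ :+ a) :* b :+ :- b) refl (fromℕ n) (invFact (suc n)) ⟩
  (1ℚ + fromℕ n) * invFact (suc n) + - invFact (suc n)
    ≡⟨ cong (λ z → z * invFact (suc n) + - invFact (suc n)) (fromℕ-homo-+ 1 n) ⟨
  fromℕ (suc n) * invFact (suc n) + - invFact (suc n)
    ≡⟨ cong (_+ - invFact (suc n)) ([1+n]*invFact[1+n]≡invFact[n] n) ⟩
  invFact n + - invFact (suc n) ∎
  where open ≡-Reasoning

θ-σexp : θ (σ exp) ≐ ⊝ (mulX (σ exp))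
θ-σexp zero    = ℚP.*-zeroˡ (sgn 0 * exp 0)
θ-σexp (suc n) = begin
  fromℕ (suc n) * (sgn (suc n) * exp (suc n))
    ≡⟨ solve 3 (λ a b c → a :* (b :* c) := b :* (a :* c)) refl (fromℕ (suc n)) (sgn (suc n)) (exp (suc n)) ⟩
  sgn (suc n) * (fromℕ (suc n) * exp (suc n))
    ≡⟨ cong₂ _*_ (sgn-suc n) ([1+n]*invFact[1+n]≡invFact[n] n) ⟩
  (- sgn n) * exp n
    ≡⟨ ℚP.neg-distribˡ-* (sgn n) (exp n) ⟨
  - (sgn n * exp n) ∎
  where open ≡-Reasoning

-- eˣ e⁻ˣ = 1 because its Euler derivative vanishes.
exp⊛σexp : exp ⊛ σ exp ≐ 𝟙
exp⊛σexp zero    = refl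
exp⊛σexp (suc k) = θ-kernel (exp ⊛ σ exp) θ[exp⊛σexp]≐𝟘 k
  where
  θ[exp⊛σexp]≐𝟘 : θ (exp ⊛ σ exp) ≐ 𝟘
  θ[exp⊛σexp]≐𝟘 = begin
    θ (exp ⊛ σ exp)                                   ≈⟨ θ-leibniz exp (σ exp) ⟩
    θ exp ⊛ σ exp ⊕ exp ⊛ θ (σ exp)                   ≈⟨ ⊕-cong (⊛-congˡ (σ exp) θ-exp) (⊛-congʳ exp θ-σexp) ⟩
    mulX exp ⊛ σ exp ⊕ exp ⊛ ⊝ (mulX (σ exp))         ≈⟨ ⊕-congʳ (mulX exp ⊛ σ exp) (-‿distribʳ-* exp (mulX (σ exp))) ⟨
    mulX exp ⊛ σ exp ⊕ ⊝ (exp ⊛ mulX (σ exp))         ≈⟨ ⊕-congʳ (mulX exp ⊛ σ exp) (-‿cong (⊛-comm exp (mulX (σ exp)))) ⟩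
    mulX exp ⊛ σ exp ⊕ ⊝ (mulX (σ exp) ⊛ exp)         ≈⟨ ⊕-cong (mulX-⊛ exp (σ exp)) (-‿cong (mulX-⊛ (σ exp) exp)) ⟩
    mulX (exp ⊛ σ exp) ⊕ ⊝ (mulX (σ exp ⊛ exp))       ≈⟨ ⊕-congʳ (mulX (exp ⊛ σ exp)) (-‿cong (mulX-cong (⊛-comm (σ exp) exp))) ⟩
    mulX (exp ⊛ σ exp) ⊕ ⊝ (mulX (exp ⊛ σ exp))       ≈⟨ -‿inverseʳ (mulX (exp ⊛ σ exp)) ⟩
    𝟘                                                 ∎
    where open ≐-Reasoning

mulX-σexpm1Over : mulX (σ expm1Over) ≐ 𝟙 ⊖ σ exp
mulX-σexpm1Over zero    = refl
mulX-σexpm1Over (suc n) = begin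
  sgn n * invFact (suc n)              ≡⟨ solve 2 (λ s x → s :* x := con 0ℚ :+ :- ((:- s) :* x)) refl (sgn n) (invFact (suc n)) ⟩
  0ℚ + - ((- sgn n) * invFact (suc n)) ≡⟨ cong (λ z → 0ℚ + - (z * invFact (suc n))) (sgn-suc n) ⟨
  0ℚ + - (sgn (suc n) * invFact (suc n)) ∎
  where open ≡-Reasoning

σexpm1Over⊛exp : σ expm1Over ⊛ exp ≐ expm1Over
σexpm1Over⊛exp n = begin
  (σ expm1Over ⊛ exp) n
    ≡⟨ mulX-⊛ (σ expm1Over) exp (suc n) ⟨
  (mulX (σ expm1Over) ⊛ exp) (suc n)
    ≡⟨ ⊛-congˡ exp mulX-σexpm1Over (suc n) ⟩
  ((𝟙 ⊖ σ exp) ⊛ exp) (suc n)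
    ≡⟨ [y-z]x≈yx-zx exp 𝟙 (σ exp) (suc n) ⟩
  (𝟙 ⊛ exp) (suc n) + - (σ exp ⊛ exp) (suc n)
    ≡⟨ cong₂ (λ a b → a + - b) (⊛-identityˡ exp (suc n)) (trans (⊛-comm (σ exp) exp (suc n)) (exp⊛σexp (suc n))) ⟩
  exp (suc n) + - 0ℚ
    ≡⟨ ℚP.+-identityʳ (exp (suc n)) ⟩
  expm1Over n ∎
  where open ≡-Reasoning

-- Both sides are inverse to σ expm1Over.
σ-todd : σ todd ≐ exp ⊛ todd
σ-todd = begin
  σ todd
    ≈⟨ ⊛-identityʳ (σ todd) ⟨
  σ todd ⊛ 𝟙
    ≈⟨ ⊛-congʳ (σ todd) (≐-trans (≐-sym (⊛-assoc (σ expm1Over) exp todd)) (≐-trans (⊛-congˡ todd σexpm1Over⊛exp) expm1Over⊛todd)) ⟨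
  σ todd ⊛ (σ expm1Over ⊛ (exp ⊛ todd))
    ≈⟨ ⊛-assoc (σ todd) (σ expm1Over) (exp ⊛ todd) ⟨
  (σ todd ⊛ σ expm1Over) ⊛ (exp ⊛ todd)
    ≈⟨ ⊛-congˡ (exp ⊛ todd) σtodd⊛σexpm1Over ⟩
  𝟙 ⊛ (exp ⊛ todd)
    ≈⟨ ⊛-identityˡ (exp ⊛ todd) ⟩
  exp ⊛ todd ∎
  where
  open ≐-Reasoning
  σtodd⊛σexpm1Over : σ todd ⊛ σ expm1Over ≐ 𝟙
  σtodd⊛σexpm1Over = ≐-trans (≐-sym (σ-⊛ todd expm1Over)) (≐-trans (σ-cong (≐-trans (⊛-comm todd expm1Over) expm1Over⊛todd)) σ-𝟙)

expm1Over⊛θtodd : expm1Over ⊛ θ todd ≐ 𝟙 ⊖ σ todd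
expm1Over⊛θtodd = begin
  expm1Over ⊛ θ todd          ≈⟨ inverseʳ-unique (θ expm1Over ⊛ todd) (expm1Over ⊛ θ todd) θ[expm1Over⊛todd]≐𝟘 ⟩
  ⊝ (θ expm1Over ⊛ todd)      ≈⟨ -‿cong θexpm1Over⊛todd ⟩
  ⊝ (σ todd ⊖ 𝟙)              ≈⟨ (λ n → solve 2 (λ a b → :- (a :+ :- b) := b :+ :- a) refl (σ todd n) (𝟙 n)) ⟩
  𝟙 ⊖ σ todd                  ∎
  where
  open ≐-Reasoning
  θ[expm1Over⊛todd]≐𝟘 : θ expm1Over ⊛ todd ⊕ expm1Over ⊛ θ todd ≐ 𝟘
  θ[expm1Over⊛todd]≐𝟘 = ≐-trans (≐-sym (θ-leibniz expm1Over todd)) (≐-trans (θ-cong expm1Over⊛todd) θ-𝟙)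
  θexpm1Over⊛todd : θ expm1Over ⊛ todd ≐ σ todd ⊖ 𝟙
  θexpm1Over⊛todd = begin
    θ expm1Over ⊛ todd                  ≈⟨ ⊛-congˡ todd θ-expm1Over ⟩
    (exp ⊖ expm1Over) ⊛ todd            ≈⟨ [y-z]x≈yx-zx todd exp expm1Over ⟩
    exp ⊛ todd ⊖ expm1Over ⊛ todd       ≈⟨ ⊕-cong (≐-sym σ-todd) (-‿cong expm1Over⊛todd) ⟩
    σ todd ⊖ 𝟙                          ∎

θ-todd : θ todd ≐ todd ⊛ (𝟙 ⊖ σ todd)
θ-todd = begin
  θ todd                          ≈⟨ ⊛-identityˡ (θ todd) ⟨
  𝟙 ⊛ θ todd                      ≈⟨ ⊛-congˡ (θ todd) (≐-trans (⊛-comm todd expm1Over) expm1Over⊛todd) ⟨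
  (todd ⊛ expm1Over) ⊛ θ todd     ≈⟨ ⊛-assoc todd expm1Over (θ todd) ⟩
  todd ⊛ (expm1Over ⊛ θ todd)     ≈⟨ ⊛-congʳ todd expm1Over⊛θtodd ⟩
  todd ⊛ (𝟙 ⊖ σ todd)             ∎
  where open ≐-Reasoning

toddPow-zero : toddPow 0 ≐ 𝟙
toddPow-zero zero    = refl
toddPow-zero (suc n) = refl

toddPow≐todd^ : ∀ m → toddPow m ≐ todd ^ m
toddPow≐todd^ zero    = toddPow-zero
toddPow≐todd^ (suc m) = ⊛-congʳ todd (toddPow≐todd^ m)

toddPow-coeff₀ : ∀ m → toddPow m 0 ≡ 1ℚ
toddPow-coeff₀ zero    = refl
toddPow-coeff₀ (suc m) = cong (todd 0 *_) (toddPow-coeff₀ m)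

expm1Over^m⊛toddPow : ∀ m → (expm1Over ^ m) ⊛ toddPow m ≐ 𝟙
expm1Over^m⊛toddPow zero    = ≐-trans (⊛-identityˡ (toddPow 0)) toddPow-zero
expm1Over^m⊛toddPow (suc m) = begin
  (expm1Over ⊛ (expm1Over ^ m)) ⊛ (todd ⊛ toddPow m)   ≈⟨ interchange expm1Over (expm1Over ^ m) todd (toddPow m) ⟩
  (expm1Over ⊛ todd) ⊛ ((expm1Over ^ m) ⊛ toddPow m)   ≈⟨ ⊛-cong expm1Over⊛todd (expm1Over^m⊛toddPow m) ⟩
  𝟙 ⊛ 𝟙                                                ≈⟨ ⊛-identityˡ 𝟙 ⟩
  𝟙                                                    ∎
  where open ≐-Reasoning

θ-toddPow : ∀ m → θ (toddPow m) ≐ toddPow m ⊛ (fromℕ m · (𝟙 ⊖ σ todd))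
θ-toddPow zero n = begin
  θ (toddPow 0) n                                    ≡⟨ θ-cong toddPow-zero n ⟩
  θ 𝟙 n                                              ≡⟨ θ-𝟙 n ⟩
  0ℚ                                                 ≡⟨ ℚP.*-zeroˡ ((toddPow 0 ⊛ (𝟙 ⊖ σ todd)) n) ⟨
  0ℚ * (toddPow 0 ⊛ (𝟙 ⊖ σ todd)) n                  ≡⟨ ⊛-·ʳ 0ℚ (toddPow 0) (𝟙 ⊖ σ todd) n ⟨
  (toddPow 0 ⊛ (fromℕ 0 · (𝟙 ⊖ σ todd))) n           ∎
  where open ≡-Reasoning
θ-toddPow (suc m) = begin
  θ (toddPow (suc m))                             ≈⟨ θ-cong (toddPow≐todd^ (suc m)) ⟩
  θ (todd ^ suc m)                                ≈⟨ θ-^ todd m ⟩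
  fromℕ (suc m) · (θ todd ⊛ (todd ^ m))           ≈⟨ ·-congʳ (fromℕ (suc m)) (⊛-cong θ-todd (≐-sym (toddPow≐todd^ m))) ⟩
  fromℕ (suc m) · ((todd ⊛ h) ⊛ toddPow m)        ≈⟨ ·-congʳ (fromℕ (suc m)) (xy∙z≈xz∙y todd h (toddPow m)) ⟩
  fromℕ (suc m) · (toddPow (suc m) ⊛ h)           ≈⟨ ⊛-·ʳ (fromℕ (suc m)) (toddPow (suc m)) h ⟨
  toddPow (suc m) ⊛ (fromℕ (suc m) · h)           ∎
  where
  open ≐-Reasoning
  h = 𝟙 ⊖ σ todd

⟦_⟧ : {P : Set} → Dec P → ℚ
⟦ P? ⟧ = if does P? then 1ℚ else 0ℚ

⟦⟧-true : ∀ {P : Set} (P? : Dec P) → P → ⟦ P? ⟧ ≡ 1ℚ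
⟦⟧-true P? p = cong (if_then 1ℚ else 0ℚ) (dec-true P? p)

⟦⟧-false : ∀ {P : Set} (P? : Dec P) → ¬ P → ⟦ P? ⟧ ≡ 0ℚ
⟦⟧-false P? ¬p = cong (if_then 1ℚ else 0ℚ) (dec-false P? ¬p)

⟦⟧-⇔ : ∀ {P Q : Set} (P? : Dec P) (Q? : Dec Q) → (P → Q) → (Q → P) → ⟦ P? ⟧ ≡ ⟦ Q? ⟧
⟦⟧-⇔ P? Q? P⇒Q Q⇒P with Q?
... | yes q = ⟦⟧-true P? (Q⇒P q)
... | no ¬q = ⟦⟧-false P? (¬q ∘ P⇒Q)

⟦⟧-absorb : ∀ {P Q : Set} (P? : Dec P) (Q? : Dec Q) → (P → Q) → ⟦ Q? ⟧ * ⟦ P? ⟧ ≡ ⟦ P? ⟧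
⟦⟧-absorb P? Q? P⇒Q with P?
... | yes p = trans (cong (_* 1ℚ) (⟦⟧-true Q? (P⇒Q p))) refl
... | no ¬p = ℚP.*-zeroʳ ⟦ Q? ⟧

⟦+≟⟧-split : ∀ a W w → ⟦ a ℕ.+ W ℕ.≟ w ⟧ ≡ ⟦ a ℕ.≤? w ⟧ * ⟦ W ℕ.≟ w ∸ a ⟧
⟦+≟⟧-split a W w = by-cases (a ℕ.≤? w)
  where
  by-cases : Dec (a ℕ.≤ w) → ⟦ a ℕ.+ W ℕ.≟ w ⟧ ≡ ⟦ a ℕ.≤? w ⟧ * ⟦ W ℕ.≟ w ∸ a ⟧
  by-cases (yes a≤w) = begin
    ⟦ a ℕ.+ W ℕ.≟ w ⟧                  ≡⟨ ⟦⟧-⇔ (a ℕ.+ W ℕ.≟ w) (W ℕ.≟ w ∸ a)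
                                            (λ a+W≡w → trans (sym (ℕP.m+n∸m≡n a W)) (cong (_∸ a) a+W≡w))
                                            (λ W≡w∸a → trans (cong (a ℕ.+_) W≡w∸a) (ℕP.m+[n∸m]≡n a≤w)) ⟩
    ⟦ W ℕ.≟ w ∸ a ⟧                    ≡⟨ ℚP.*-identityˡ ⟦ W ℕ.≟ w ∸ a ⟧ ⟨
    1ℚ * ⟦ W ℕ.≟ w ∸ a ⟧               ≡⟨ cong (_* ⟦ W ℕ.≟ w ∸ a ⟧) (⟦⟧-true (a ℕ.≤? w) a≤w) ⟨
    ⟦ a ℕ.≤? w ⟧ * ⟦ W ℕ.≟ w ∸ a ⟧     ∎
    where open ≡-Reasoning
  by-cases (no a≰w) = begin
    ⟦ a ℕ.+ W ℕ.≟ w ⟧                  ≡⟨ ⟦⟧-false (a ℕ.+ W ℕ.≟ w) (λ a+W≡w → a≰w (subst (a ℕ.≤_) a+W≡w (ℕP.m≤m+n a W))) ⟩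
    0ℚ                                 ≡⟨ ℚP.*-zeroˡ ⟦ W ℕ.≟ w ∸ a ⟧ ⟨
    0ℚ * ⟦ W ℕ.≟ w ∸ a ⟧               ≡⟨ cong (_* ⟦ W ℕ.≟ w ∸ a ⟧) (⟦⟧-false (a ℕ.≤? w) a≰w) ⟨
    ⟦ a ℕ.≤? w ⟧ * ⟦ W ℕ.≟ w ∸ a ⟧     ∎
    where open ≡-Reasoning

⟦≟⟧-subst : ∀ d i (φ : ℕ → ℚ) → ⟦ d ℕ.≟ i ⟧ * φ i ≡ ⟦ d ℕ.≟ i ⟧ * φ d
⟦≟⟧-subst d i φ with d ℕ.≟ i
... | yes refl = refl
... | no  d≢i  = trans (cong (_* φ i) (⟦⟧-false (d ℕ.≟ i) d≢i)) (trans (ℚP.*-zeroˡ (φ i))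
                   (sym (trans (cong (_* φ d) (⟦⟧-false (d ℕ.≟ i) d≢i)) (ℚP.*-zeroˡ (φ d)))))

⟦≤?⟧-suc : ∀ d n → ⟦ d ℕ.≤? suc n ⟧ ≡ ⟦ d ℕ.≤? n ⟧ + ⟦ d ℕ.≟ suc n ⟧
⟦≤?⟧-suc d n with ℕP.<-cmp d (suc n)
... | tri< d<1+n d≢1+n _ = trans (⟦⟧-true (d ℕ.≤? suc n) (ℕP.<⇒≤ d<1+n))
                             (sym (cong₂ _+_ (⟦⟧-true (d ℕ.≤? n) (ℕP.≤-pred d<1+n)) (⟦⟧-false (d ℕ.≟ suc n) d≢1+n)))
... | tri≈ _ d≡1+n _     = trans (⟦⟧-true (d ℕ.≤? suc n) (ℕP.≤-reflexive d≡1+n))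
                             (sym (cong₂ _+_ (⟦⟧-false (d ℕ.≤? n) (λ d≤n → ℕP.n≮n n (subst (ℕ._≤ n) d≡1+n d≤n)))
                                              (⟦⟧-true (d ℕ.≟ suc n) d≡1+n)))
... | tri> _ d≢1+n 1+n<d = trans (⟦⟧-false (d ℕ.≤? suc n) (ℕP.<⇒≱ 1+n<d))
                             (sym (cong₂ _+_ (⟦⟧-false (d ℕ.≤? n) (ℕP.<⇒≱ (ℕP.<⇒≤ 1+n<d))) (⟦⟧-false (d ℕ.≟ suc n) d≢1+n)))

sumTo-delta : ∀ n d (φ : ℕ → ℚ) → sumTo n (λ i → ⟦ d ℕ.≟ i ⟧ * φ i) ≡ ⟦ d ℕ.≤? n ⟧ * φ d
sumTo-delta zero    d φ = trans (⟦≟⟧-subst d 0 φ)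
  (cong (_* φ d) (⟦⟧-⇔ (d ℕ.≟ 0) (d ℕ.≤? 0) ℕP.≤-reflexive ℕP.n≤0⇒n≡0))
sumTo-delta (suc n) d φ = begin
  sumTo n (λ i → ⟦ d ℕ.≟ i ⟧ * φ i) + ⟦ d ℕ.≟ suc n ⟧ * φ (suc n)
    ≡⟨ cong₂ _+_ (sumTo-delta n d φ) (⟦≟⟧-subst d (suc n) φ) ⟩
  ⟦ d ℕ.≤? n ⟧ * φ d + ⟦ d ℕ.≟ suc n ⟧ * φ d
    ≡⟨ ℚP.*-distribʳ-+ (φ d) ⟦ d ℕ.≤? n ⟧ ⟦ d ℕ.≟ suc n ⟧ ⟨
  (⟦ d ℕ.≤? n ⟧ + ⟦ d ℕ.≟ suc n ⟧) * φ d
    ≡⟨ cong (_* φ d) (⟦≤?⟧-suc d n) ⟨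
  ⟦ d ℕ.≤? suc n ⟧ * φ d ∎
  where open ≡-Reasoning

sumOver : {A : Set} → (A → ℚ) → List A → ℚ
sumOver h xs = sumℚ (map h xs)

module _ {A : Set} where

  sumOver-cong : ∀ {h h′ : A → ℚ} xs → (∀ x → h x ≡ h′ x) → sumOver h xs ≡ sumOver h′ xs
  sumOver-cong []       h≡h′ = refl
  sumOver-cong (x ∷ xs) h≡h′ = cong₂ _+_ (h≡h′ x) (sumOver-cong xs h≡h′)

  sumOver-++ : ∀ (h : A → ℚ) xs ys → sumOver h (xs ++ ys) ≡ sumOver h xs + sumOver h ys
  sumOver-++ h []       ys = sym (ℚP.+-identityˡ (sumOver h ys))
  sumOver-++ h (x ∷ xs) ys = trans (cong (λ z → h x + z) (sumOver-++ h xs ys)) (sym (ℚP.+-assoc (h x) (sumOver h xs) (sumOver h ys)))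

  *-distribˡ-sumOver : ∀ c (h : A → ℚ) xs → c * sumOver h xs ≡ sumOver (λ x → c * h x) xs
  *-distribˡ-sumOver c h []       = ℚP.*-zeroʳ c
  *-distribˡ-sumOver c h (x ∷ xs) = trans (ℚP.*-distribˡ-+ c (h x) (sumOver h xs)) (cong (λ z → c * h x + z) (*-distribˡ-sumOver c h xs))

  sumOver-filter : ∀ {P : A → Set} (P? : Decidable P) (h : A → ℚ) xs →
                   sumOver h (filter P? xs) ≡ sumOver (λ x → ⟦ P? x ⟧ * h x) xs
  sumOver-filter P? h []       = refl
  sumOver-filter P? h (x ∷ xs) with P? x
  ... | yes _ = cong₂ _+_ (sym (ℚP.*-identityˡ (h x))) (sumOver-filter P? h xs)
  ... | no  _ = trans (sumOver-filter P? h xs) (sym (trans (cong (_+ _) (ℚP.*-zeroˡ (h x))) (ℚP.+-identityˡ _)))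

  sumOver-sumTo : ∀ N (F : A → ℕ → ℚ) xs → sumOver (λ x → sumTo N (F x)) xs ≡ sumTo N (λ s → sumOver (λ x → F x s) xs)
  sumOver-sumTo N F []       = sym (sumTo-zero N (λ _ _ → refl))
  sumOver-sumTo N F (x ∷ xs) = trans (cong (λ z → sumTo N (F x) + z) (sumOver-sumTo N F xs)) (sym (sumTo-+ N (F x) (λ s → sumOver (λ x → F x s) xs)))

  sumOver-applyUpTo : ∀ (h : A → ℚ) (f : ℕ → A) b → sumOver h (applyUpTo f (suc b)) ≡ sumTo b (h ∘ f)
  sumOver-applyUpTo h f zero    = ℚP.+-identityʳ (h (f 0))
  sumOver-applyUpTo h f (suc b) = trans (cong (λ z → h (f 0) + z) (sumOver-applyUpTo h (f ∘ suc) b)) (sym (sumTo-sucˡ b (h ∘ f)))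

module _ {A B : Set} where

  sumOver-map : ∀ (h : B → ℚ) (f : A → B) xs → sumOver h (map f xs) ≡ sumOver (h ∘ f) xs
  sumOver-map h f []       = refl
  sumOver-map h f (x ∷ xs) = cong (λ z → h (f x) + z) (sumOver-map h f xs)

  sumOver-concatMap : ∀ (h : B → ℚ) (f : A → List B) xs → sumOver h (concatMap f xs) ≡ sumOver (λ x → sumOver h (f x)) xs
  sumOver-concatMap h f []       = refl
  sumOver-concatMap h f (x ∷ xs) = trans (sumOver-++ h (f x) (concatMap f xs)) (cong (λ z → sumOver h (f x) + z) (sumOver-concatMap h f xs))

-- The binomial and multinomial theorems

monomial : ℕ → ℚ → Series
monomial d a i = ⟦ d ℕ.≟ i ⟧ * a

monomial-⊛ : ∀ d a h w → (monomial d a ⊛ h) w ≡ ⟦ d ℕ.≤? w ⟧ * (a * h (w ∸ d))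
monomial-⊛ d a h w = trans (sumTo-cong w (λ i → ℚP.*-assoc ⟦ d ℕ.≟ i ⟧ a (h (w ∸ i)))) (sumTo-delta w d (λ i → a * h (w ∸ i)))

monomial-⊛-monomial : ∀ d e a b → monomial d a ⊛ monomial e b ≐ monomial (d ℕ.+ e) (a * b)
monomial-⊛-monomial d e a b w = begin
  (monomial d a ⊛ monomial e b) w
    ≡⟨ monomial-⊛ d a (monomial e b) w ⟩
  ⟦ d ℕ.≤? w ⟧ * (a * (⟦ e ℕ.≟ w ∸ d ⟧ * b))
    ≡⟨ solve 4 (λ p a q b → p :* (a :* (q :* b)) := p :* q :* (a :* b)) refl ⟦ d ℕ.≤? w ⟧ a ⟦ e ℕ.≟ w ∸ d ⟧ b ⟩
  ⟦ d ℕ.≤? w ⟧ * ⟦ e ℕ.≟ w ∸ d ⟧ * (a * b)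
    ≡⟨ cong (_* (a * b)) (⟦+≟⟧-split d e w) ⟨
  ⟦ d ℕ.+ e ℕ.≟ w ⟧ * (a * b) ∎
  where open ≡-Reasoning

monomial-^ : ∀ d a x → monomial d a ^ x ≐ monomial (d ℕ.* x) (a ^ℚ x)
monomial-^ d a zero i rewrite ℕP.*-zeroʳ d with i
... | zero  = refl
... | suc _ = refl
monomial-^ d a (suc x) = begin
  monomial d a ⊛ (monomial d a ^ x)                 ≈⟨ ⊛-congʳ (monomial d a) (monomial-^ d a x) ⟩
  monomial d a ⊛ monomial (d ℕ.* x) (a ^ℚ x)        ≈⟨ monomial-⊛-monomial d (d ℕ.* x) a (a ^ℚ x) ⟩
  monomial (d ℕ.+ d ℕ.* x) (a ^ℚ suc x)             ≈⟨ (λ i → cong (λ e → monomial e (a ^ℚ suc x) i) (ℕP.*-suc d x)) ⟨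
  monomial (d ℕ.* suc x) (a ^ℚ suc x)               ∎
  where open ≐-Reasoning

×-fromℕ : ∀ n f w → (n × f) w ≡ fromℕ n * f w
×-fromℕ zero    f w = sym (ℚP.*-zeroˡ (f w))
×-fromℕ (suc n) f w = begin
  f w + (n × f) w              ≡⟨ cong (λ z → f w + z) (×-fromℕ n f w) ⟩
  f w + fromℕ n * f w          ≡⟨ solve 2 (λ a x → x :+ a :* x := (con 1ℚ :+ a) :* x) refl (fromℕ n) (f w) ⟩
  (1ℚ + fromℕ n) * f w         ≡⟨ cong (_* f w) (fromℕ-homo-+ 1 n) ⟨
  fromℕ (suc n) * f w          ∎
  where open ≡-Reasoning

sum-sumTo : ∀ s (F : ℕ → Series) w → sum {suc s} (λ k → F (toℕ k)) w ≡ sumTo s (λ x → F x w)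
sum-sumTo zero    F w = ℚP.+-identityʳ (F 0 w)
sum-sumTo (suc s) F w = trans (cong (λ z → F 0 w + z) (sum-sumTo s (F ∘ suc) w)) (sym (sumTo-sucˡ s (λ x → F x w)))

binomial : ∀ s f g w → ((f ⊕ g) ^ s) w ≡ sumTo s (λ x → fromℕ (s C x) * ((f ^ x) ⊛ (g ^ (s ∸ x))) w)
binomial s f g w = begin
  ((f ⊕ g) ^ s) w
    ≡⟨ Binomial.theorem s f g w ⟩
  sum {suc s} (λ k → (s C toℕ k) × ((f ^ toℕ k) ⊛ (g ^ (s ∸ toℕ k)))) w
    ≡⟨ sum-sumTo s (λ x → (s C x) × ((f ^ x) ⊛ (g ^ (s ∸ x)))) w ⟩
  sumTo s (λ x → ((s C x) × ((f ^ x) ⊛ (g ^ (s ∸ x)))) w)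
    ≡⟨ sumTo-cong s (λ x → ×-fromℕ (s C x) ((f ^ x) ⊛ (g ^ (s ∸ x))) w) ⟩
  sumTo s (λ x → fromℕ (s C x) * ((f ^ x) ⊛ (g ^ (s ∸ x))) w) ∎
  where open ≡-Reasoning

binomial-monomial : ∀ s d a g w →
  ((monomial d a ⊕ g) ^ s) w ≡ sumTo s (λ x → fromℕ (s C x) * (⟦ d ℕ.* x ℕ.≤? w ⟧ * (a ^ℚ x * (g ^ (s ∸ x)) (w ∸ d ℕ.* x))))
binomial-monomial s d a g w = trans (binomial s (monomial d a) g w) (sumTo-cong s (λ x → cong (fromℕ (s C x) *_)
  (trans (⊛-congˡ (g ^ (s ∸ x)) (monomial-^ d a x) w) (monomial-⊛ (d ℕ.* x) (a ^ℚ x) (g ^ (s ∸ x)) w))))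

n!*invFact[k]≡nCk*[n∸k]! : ∀ n k → k ℕ.≤ n → factℚ n * invFact k ≡ fromℕ (n C k) * factℚ (n ∸ k)
n!*invFact[k]≡nCk*[n∸k]! n k k≤n = begin
  factℚ n * invFact k
    ≡⟨ cong (λ z → fromℕ z * invFact k) nCk*k!*[n∸k]!≡n! ⟨
  fromℕ ((n C k) ℕ.* (k ! ℕ.* (n ∸ k) !)) * invFact k
    ≡⟨ cong (_* invFact k) (trans (fromℕ-homo-* (n C k) _) (cong (fromℕ (n C k) *_) (fromℕ-homo-* (k !) ((n ∸ k) !)))) ⟩
  fromℕ (n C k) * (factℚ k * factℚ (n ∸ k)) * invFact k
    ≡⟨ solve 4 (λ a b c d → a :* (b :* c) :* d := a :* c :* (d :* b)) refl (fromℕ (n C k)) (factℚ k) (factℚ (n ∸ k)) (invFact k) ⟩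
  fromℕ (n C k) * factℚ (n ∸ k) * (invFact k * factℚ k)
    ≡⟨ cong (fromℕ (n C k) * factℚ (n ∸ k) *_) (invFact*factℚ≡1 k) ⟩
  fromℕ (n C k) * factℚ (n ∸ k) * 1ℚ
    ≡⟨ ℚP.*-identityʳ _ ⟩
  fromℕ (n C k) * factℚ (n ∸ k) ∎
  where
  open ≡-Reasoning
  instance _ = k !* (n ∸ k) !≢0
  nCk*k!*[n∸k]!≡n! : (n C k) ℕ.* (k ! ℕ.* (n ∸ k) !) ≡ n !
  nCk*k!*[n∸k]!≡n! = trans (cong (ℕ._* (k ! ℕ.* (n ∸ k) !)) (nCk≡n!/k![n-k]! k≤n)) (m/n*n≡m (k![n∸k]!∣n! k≤n))

n!*[k≤n]*invFact[k]≡nCk*[n∸k]! : ∀ n k → factℚ n * (⟦ k ℕ.≤? n ⟧ * invFact k) ≡ fromℕ (n C k) * factℚ (n ∸ k)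
n!*[k≤n]*invFact[k]≡nCk*[n∸k]! n k with k ℕ.≤? n
... | yes k≤n = begin
  factℚ n * (⟦ k ℕ.≤? n ⟧ * invFact k)   ≡⟨ cong (λ p → factℚ n * (p * invFact k)) (⟦⟧-true (k ℕ.≤? n) k≤n) ⟩
  factℚ n * (1ℚ * invFact k)            ≡⟨ cong (factℚ n *_) (ℚP.*-identityˡ (invFact k)) ⟩
  factℚ n * invFact k                   ≡⟨ n!*invFact[k]≡nCk*[n∸k]! n k k≤n ⟩
  fromℕ (n C k) * factℚ (n ∸ k)         ∎
  where open ≡-Reasoning
... | no  k≰n = begin
  factℚ n * (⟦ k ℕ.≤? n ⟧ * invFact k)
    ≡⟨ cong (λ p → factℚ n * (p * invFact k)) (⟦⟧-false (k ℕ.≤? n) k≰n) ⟩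
  factℚ n * (0ℚ * invFact k)
    ≡⟨ solve 3 (λ f i g → f :* (con 0ℚ :* i) := con 0ℚ :* g) refl (factℚ n) (invFact k) (factℚ (n ∸ k)) ⟩
  0ℚ * factℚ (n ∸ k)
    ≡⟨ cong (λ c → fromℕ c * factℚ (n ∸ k)) (k>n⇒nCk≡0 (ℕP.≰⇒> k≰n)) ⟨
  fromℕ (n C k) * factℚ (n ∸ k) ∎
  where open ≡-Reasoning

vsum≤wsum : ∀ j {n} (v : Vec ℕ n) → vsum v ℕ.≤ wsum (suc j) v
vsum≤wsum j []       = z≤n
vsum≤wsum j (x ∷ xs) = ℕP.+-mono-≤ (ℕP.m≤m+n x (j ℕ.* x)) (vsum≤wsum (suc j) xs)

module Multinomial (m : ℕ) where

  coeff : ℕ → ℚ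
  coeff j = B[ m ] j * invFact j

  window : ℕ → ℕ → Series
  window j zero    = 𝟘
  window j (suc n) = monomial j (coeff j) ⊕ window (suc j) n

  window-below : ∀ j n i → i ℕ.< j → window j n i ≡ 0ℚ
  window-below j zero    i i<j = refl
  window-below j (suc n) i i<j = begin
    ⟦ j ℕ.≟ i ⟧ * coeff j + window (suc j) n i
      ≡⟨ cong₂ (λ a b → a * coeff j + b) (⟦⟧-false (j ℕ.≟ i) (ℕP.>⇒≢ i<j)) (window-below (suc j) n i (ℕP.m<n⇒m<1+n i<j)) ⟩
    0ℚ * coeff j + 0ℚ
      ≡⟨ solve 1 (λ c → con 0ℚ :* c :+ con 0ℚ := con 0ℚ) refl (coeff j) ⟩
    0ℚ ∎
    where open ≡-Reasoning

  window-inside : ∀ j n i → j ℕ.≤ i → i ℕ.< j ℕ.+ n → window j n i ≡ coeff i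
  window-inside j zero    i j≤i i<j+0 = contradiction (ℕP.≤-<-trans j≤i i<j+0) (λ j<j+0 → ℕP.<-irrefl (sym (ℕP.+-identityʳ j)) j<j+0)
  window-inside j (suc n) i j≤i i<j+1+n with j ℕ.≟ i
  ... | yes refl = begin
    ⟦ i ℕ.≟ i ⟧ * coeff i + window (suc i) n i
      ≡⟨ cong₂ (λ a b → a * coeff i + b) (⟦⟧-true (i ℕ.≟ i) refl) (window-below (suc i) n i (ℕP.n<1+n i)) ⟩
    1ℚ * coeff i + 0ℚ
      ≡⟨ solve 1 (λ c → con 1ℚ :* c :+ con 0ℚ := c) refl (coeff i) ⟩
    coeff i ∎
    where open ≡-Reasoning
  ... | no j≢i = begin
    ⟦ j ℕ.≟ i ⟧ * coeff j + window (suc j) n i   ≡⟨ cong₂ (λ a b → a * coeff j + b) (⟦⟧-false (j ℕ.≟ i) j≢i)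
                                                       (window-inside (suc j) n i (ℕP.≤∧≢⇒< j≤i j≢i) (subst (i ℕ.<_) (ℕP.+-suc j n) i<j+1+n)) ⟩
    0ℚ * coeff j + coeff i                        ≡⟨ solve 2 (λ c d → con 0ℚ :* c :+ d := d) refl (coeff j) (coeff i) ⟩
    coeff i                                       ∎
    where open ≡-Reasoning

  module _ (b : ℕ) where

    tupleSum : (j n w s : ℕ) → ℚ
    tupleSum j n w s = sumOver (λ v → ⟦ wsum j v ℕ.≟ w ⟧ * (⟦ vsum v ℕ.≟ s ⟧ * prodTerm m j v)) (allVecs b n)

    tupleSum-suc : ∀ j n w s → tupleSum j (suc n) w s ≡
      sumTo b (λ x → ⟦ j ℕ.* x ℕ.≤? w ⟧ * ⟦ x ℕ.≤? s ⟧ * (invFact x * (coeff j ^ℚ x)) * tupleSum (suc j) n (w ∸ j ℕ.* x) (s ∸ x))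
    tupleSum-suc j n w s = begin
      sumOver H (concatMap (λ x → map (x ∷_) (allVecs b n)) (upTo (suc b)))
        ≡⟨ sumOver-concatMap H (λ x → map (x ∷_) (allVecs b n)) (upTo (suc b)) ⟩
      sumOver (λ x → sumOver H (map (x ∷_) (allVecs b n))) (upTo (suc b))
        ≡⟨ sumOver-applyUpTo (λ x → sumOver H (map (x ∷_) (allVecs b n))) id b ⟩
      sumTo b (λ x → sumOver H (map (x ∷_) (allVecs b n)))
        ≡⟨ sumTo-cong b (λ x → trans (sumOver-map H (x ∷_) (allVecs b n)) (sumOver-cong (allVecs b n) (H-∷ x))) ⟩
      sumTo b (λ x → sumOver (λ v → L x * H′ x v) (allVecs b n))
        ≡⟨ sumTo-cong b (λ x → *-distribˡ-sumOver (L x) (H′ x) (allVecs b n)) ⟨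
      sumTo b (λ x → L x * tupleSum (suc j) n (w ∸ j ℕ.* x) (s ∸ x)) ∎
      where
      open ≡-Reasoning
      H : ∀ {n} → Vec ℕ n → ℚ
      H v = ⟦ wsum j v ℕ.≟ w ⟧ * (⟦ vsum v ℕ.≟ s ⟧ * prodTerm m j v)
      L : ℕ → ℚ
      L x = ⟦ j ℕ.* x ℕ.≤? w ⟧ * ⟦ x ℕ.≤? s ⟧ * (invFact x * (coeff j ^ℚ x))
      H′ : ℕ → Vec ℕ n → ℚ
      H′ x v = ⟦ wsum (suc j) v ℕ.≟ w ∸ j ℕ.* x ⟧ * (⟦ vsum v ℕ.≟ s ∸ x ⟧ * prodTerm m (suc j) v)
      H-∷ : ∀ x v → H (x ∷ v) ≡ L x * H′ x v
      H-∷ x v = trans (cong₂ (λ p q → p * (q * (invFact x * (coeff j ^ℚ x) * prodTerm m (suc j) v)))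
                              (⟦+≟⟧-split (j ℕ.* x) (wsum (suc j) v) w) (⟦+≟⟧-split x (vsum v) s))
        (solve 7 (λ a b c d k l p → a :* b :* (c :* d :* (k :* l :* p)) := a :* c :* (k :* l) :* (b :* (d :* p))) refl
           ⟦ j ℕ.* x ℕ.≤? w ⟧ ⟦ wsum (suc j) v ℕ.≟ w ∸ j ℕ.* x ⟧ ⟦ x ℕ.≤? s ⟧ ⟦ vsum v ℕ.≟ s ∸ x ⟧
           (invFact x) (coeff j ^ℚ x) (prodTerm m (suc j) v))

    -- Bounding the entries by b loses nothing, since an entry x that contributes has x ≤ (j + 1) x ≤ w ≤ b.
    multinomial : ∀ j n w s → w ℕ.≤ b → factℚ s * tupleSum (suc j) n w s ≡ (window (suc j) n ^ s) w
    multinomial j zero zero    zero    _ = refl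
    multinomial j zero (suc w) zero    _ = refl
    multinomial j zero w       (suc s) _ = begin
      factℚ (suc s) * (⟦ 0 ℕ.≟ w ⟧ * (0ℚ * 1ℚ) + 0ℚ)
        ≡⟨ cong (factℚ (suc s) *_) (solve 1 (λ p → p :* (con 0ℚ :* con 1ℚ) :+ con 0ℚ := con 0ℚ) refl ⟦ 0 ℕ.≟ w ⟧) ⟩
      factℚ (suc s) * 0ℚ
        ≡⟨ ℚP.*-zeroʳ (factℚ (suc s)) ⟩
      0ℚ
        ≡⟨ ⊛-zeroˡ (𝟘 ^ s) w ⟨
      (𝟘 ^ suc s) w ∎
      where open ≡-Reasoning
    multinomial j (suc n) w s w≤b = begin
      factℚ s * tupleSum (suc j) (suc n) w s  ≡⟨ cong (factℚ s *_) (tupleSum-suc (suc j) n w s) ⟩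
      factℚ s * sumTo b L                     ≡⟨ *-distribˡ-sumTo b (factℚ s) L ⟩
      sumTo b (λ x → factℚ s * L x)           ≡⟨ sumTo-cong b termwise ⟩
      sumTo b Ψ                               ≡⟨ sumTo-trim b s Ψ Ψ-beyond-b Ψ-beyond-s ⟩
      sumTo s Ψ                               ≡⟨ binomial-monomial s (suc j) (coeff (suc j)) R w ⟨
      (window (suc j) (suc n) ^ s) w          ∎
      where
      open ≡-Reasoning
      R = window (suc (suc j)) n
      I : ℕ → ℚ
      I x = ⟦ suc j ℕ.* x ℕ.≤? w ⟧
      c^ : ℕ → ℚ
      c^ x = coeff (suc j) ^ℚ x
      V : ℕ → ℚ
      V x = tupleSum (suc (suc j)) n (w ∸ suc j ℕ.* x) (s ∸ x)
      L : ℕ → ℚ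
      L x = I x * ⟦ x ℕ.≤? s ⟧ * (invFact x * c^ x) * V x
      T : ℕ → ℚ
      T x = c^ x * (R ^ (s ∸ x)) (w ∸ suc j ℕ.* x)
      Ψ : ℕ → ℚ
      Ψ x = fromℕ (s C x) * (I x * T x)
      termwise : ∀ x → factℚ s * L x ≡ Ψ x
      termwise x = begin
        factℚ s * (I x * ⟦ x ℕ.≤? s ⟧ * (invFact x * c^ x) * V x)
          ≡⟨ solve 6 (λ f i d k c v → f :* (i :* d :* (k :* c) :* v) := f :* (d :* k) :* (i :* (c :* v))) refl
               (factℚ s) (I x) ⟦ x ℕ.≤? s ⟧ (invFact x) (c^ x) (V x) ⟩
        factℚ s * (⟦ x ℕ.≤? s ⟧ * invFact x) * (I x * (c^ x * V x))
          ≡⟨ cong (_* (I x * (c^ x * V x))) (n!*[k≤n]*invFact[k]≡nCk*[n∸k]! s x) ⟩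
        fromℕ (s C x) * factℚ (s ∸ x) * (I x * (c^ x * V x))
          ≡⟨ solve 5 (λ a f i c v → a :* f :* (i :* (c :* v)) := a :* (i :* (c :* (f :* v)))) refl
               (fromℕ (s C x)) (factℚ (s ∸ x)) (I x) (c^ x) (V x) ⟩
        fromℕ (s C x) * (I x * (c^ x * (factℚ (s ∸ x) * V x)))
          ≡⟨ cong (λ z → fromℕ (s C x) * (I x * (c^ x * z)))
               (multinomial (suc j) n (w ∸ suc j ℕ.* x) (s ∸ x) (ℕP.≤-trans (ℕP.m∸n≤m w (suc j ℕ.* x)) w≤b)) ⟩
        Ψ x ∎
      Ψ-beyond-b : ∀ x → b ℕ.< x → Ψ x ≡ 0ℚ
      Ψ-beyond-b x b<x = trans (cong (λ p → fromℕ (s C x) * (p * T x)) (⟦⟧-false (suc j ℕ.* x ℕ.≤? w) [1+j]x≰w))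
                               (solve 2 (λ c t → c :* (con 0ℚ :* t) := con 0ℚ) refl (fromℕ (s C x)) (T x))
        where
        [1+j]x≰w : ¬ suc j ℕ.* x ℕ.≤ w
        [1+j]x≰w [1+j]x≤w = ℕP.<⇒≱ b<x (ℕP.≤-trans (ℕP.≤-trans (ℕP.m≤n*m x (suc j)) [1+j]x≤w) w≤b)
      Ψ-beyond-s : ∀ x → s ℕ.< x → Ψ x ≡ 0ℚ
      Ψ-beyond-s x s<x = trans (cong (λ c → fromℕ c * (I x * T x)) (k>n⇒nCk≡0 s<x)) (ℚP.*-zeroˡ (I x * T x))

  coeff≡toddPow : ∀ i → coeff i ≡ toddPow m i
  coeff≡toddPow i = begin
    factℚ i * toddPow m i * invFact i
      ≡⟨ solve 3 (λ f t v → f :* t :* v := t :* (v :* f)) refl (factℚ i) (toddPow m i) (invFact i) ⟩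
    toddPow m i * (invFact i * factℚ i)
      ≡⟨ cong (toddPow m i *_) (invFact*factℚ≡1 i) ⟩
    toddPow m i * 1ℚ
      ≡⟨ ℚP.*-identityʳ (toddPow m i) ⟩
    toddPow m i ∎
    where open ≡-Reasoning

  window-agreeUpTo : ∀ k → AgreeUpTo k (window 1 k) (toddPow m ⊖ 𝟙)
  window-agreeUpTo k zero    _   = trans (window-below 1 k 0 (s≤s z≤n)) (sym (cong (_+ - 1ℚ) (toddPow-coeff₀ m)))
  window-agreeUpTo k (suc i) i<k = begin
    window 1 k (suc i)           ≡⟨ window-inside 1 k (suc i) (s≤s z≤n) (s≤s i<k) ⟩
    coeff (suc i)                ≡⟨ coeff≡toddPow (suc i) ⟩
    toddPow m (suc i)            ≡⟨ ℚP.+-identityʳ (toddPow m (suc i)) ⟨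
    toddPow m (suc i) + - 0ℚ     ∎
    where open ≡-Reasoning

  tupleSum≡coeff-of-power : ∀ k s → tupleSum k 1 k k s ≡ invFact s * ((toddPow m ⊖ 𝟙) ^ s) k
  tupleSum≡coeff-of-power k s = begin
    tupleSum k 1 k k s                          ≡⟨ ℚP.*-identityˡ _ ⟨
    1ℚ * tupleSum k 1 k k s                     ≡⟨ cong (_* tupleSum k 1 k k s) (invFact*factℚ≡1 s) ⟨
    invFact s * factℚ s * tupleSum k 1 k k s    ≡⟨ ℚP.*-assoc (invFact s) (factℚ s) _ ⟩
    invFact s * (factℚ s * tupleSum k 1 k k s)  ≡⟨ cong (invFact s *_) (multinomial k 0 k k s ℕP.≤-refl) ⟩
    invFact s * (window 1 k ^ s) k              ≡⟨ cong (invFact s *_) (^-agreeUpTo k s (window-agreeUpTo k) k ℕP.≤-refl) ⟩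
    invFact s * ((toddPow m ⊖ 𝟙) ^ s) k         ∎
    where open ≡-Reasoning

-- The left-hand side as −[xᵏ] log a

partsWeight : ℕ → ℚ
partsWeight s = sgn s * factℚ (s ∸ 1)

LHS≡sumTo-tupleSum : ∀ k m → LHS k m ≡ sumTo k (λ s → partsWeight s * Multinomial.tupleSum m k 1 k k s)
LHS≡sumTo-tupleSum k m = begin
  sumOver (term m) (tuples k)
    ≡⟨ sumOver-filter (λ v → wsum 1 v ℕ.≟ k) (term m) (allVecs k k) ⟩
  sumOver (λ v → ⟦ wsum 1 v ℕ.≟ k ⟧ * term m v) (allVecs k k)
    ≡⟨ sumOver-cong (allVecs k k) split-by-size ⟩
  sumOver (λ v → sumTo k (λ s → partsWeight s * H s v)) (allVecs k k)
    ≡⟨ sumOver-sumTo k (λ v s → partsWeight s * H s v) (allVecs k k) ⟩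
  sumTo k (λ s → sumOver (λ v → partsWeight s * H s v) (allVecs k k))
    ≡⟨ sumTo-cong k (λ s → *-distribˡ-sumOver (partsWeight s) (H s) (allVecs k k)) ⟨
  sumTo k (λ s → partsWeight s * Multinomial.tupleSum m k 1 k k s) ∎
  where
  open ≡-Reasoning
  H : ℕ → Vec ℕ k → ℚ
  H s v = ⟦ wsum 1 v ℕ.≟ k ⟧ * (⟦ vsum v ℕ.≟ s ⟧ * prodTerm m 1 v)
  split-by-size : ∀ v → ⟦ wsum 1 v ℕ.≟ k ⟧ * term m v ≡ sumTo k (λ s → partsWeight s * H s v)
  split-by-size v = sym (begin
    sumTo k (λ s → partsWeight s * (W * (⟦ vsum v ℕ.≟ s ⟧ * P)))
      ≡⟨ sumTo-cong k (λ s → solve 4 (λ f w d p → f :* (w :* (d :* p)) := d :* (f :* (w :* p))) refl (partsWeight s) W ⟦ vsum v ℕ.≟ s ⟧ P) ⟩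
    sumTo k (λ s → ⟦ vsum v ℕ.≟ s ⟧ * (partsWeight s * (W * P)))
      ≡⟨ sumTo-delta k (vsum v) (λ s → partsWeight s * (W * P)) ⟩
    ⟦ vsum v ℕ.≤? k ⟧ * (partsWeight (vsum v) * (W * P))
      ≡⟨ solve 4 (λ d f w p → d :* (f :* (w :* p)) := d :* w :* (f :* p)) refl ⟦ vsum v ℕ.≤? k ⟧ (partsWeight (vsum v)) W P ⟩
    ⟦ vsum v ℕ.≤? k ⟧ * W * (partsWeight (vsum v) * P)
      ≡⟨ cong (_* (partsWeight (vsum v) * P)) (⟦⟧-absorb (wsum 1 v ℕ.≟ k) (vsum v ℕ.≤? k) vsum≤k) ⟩
    W * (partsWeight (vsum v) * P) ∎)
    where
    W = ⟦ wsum 1 v ℕ.≟ k ⟧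
    P = prodTerm m 1 v
    vsum≤k : wsum 1 v ≡ k → vsum v ℕ.≤ k
    vsum≤k w≡k = subst (vsum v ℕ.≤_) w≡k (vsum≤wsum 0 v)

LHS≡-logTrunc : ∀ k m → LHS (suc k) m ≡ - logTrunc (toddPow m ⊖ 𝟙) k (suc k)
LHS≡-logTrunc k m = begin
  LHS (suc k) m
    ≡⟨ LHS≡sumTo-tupleSum (suc k) m ⟩
  sumTo (suc k) (λ s → partsWeight s * Multinomial.tupleSum m (suc k) 1 (suc k) (suc k) s)
    ≡⟨ sumTo-cong (suc k) (λ s → cong (partsWeight s *_) (Multinomial.tupleSum≡coeff-of-power m (suc k) s)) ⟩
  sumTo (suc k) (λ s → partsWeight s * (invFact s * (g ^ s) (suc k)))
    ≡⟨ sumTo-sucˡ k _ ⟩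
  0ℚ + sumTo k (λ s → partsWeight (suc s) * (invFact (suc s) * (g ^ suc s) (suc k)))
    ≡⟨ ℚP.+-identityˡ _ ⟩
  sumTo k (λ s → partsWeight (suc s) * (invFact (suc s) * (g ^ suc s) (suc k)))
    ≡⟨ sumTo-cong k termwise ⟩
  sumTo k (λ s → - (sgn s * (+ 1 / suc s) * (g ^ suc s) (suc k)))
    ≡⟨ neg-distrib-sumTo k _ ⟨
  - logTrunc g k (suc k) ∎
  where
  open ≡-Reasoning
  g = toddPow m ⊖ 𝟙
  termwise : ∀ s → partsWeight (suc s) * (invFact (suc s) * (g ^ suc s) (suc k)) ≡ - (sgn s * (+ 1 / suc s) * (g ^ suc s) (suc k))
  termwise s = begin
    sgn (suc s) * factℚ s * (invFact (suc s) * X)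
      ≡⟨ cong (λ z → z * factℚ s * (invFact (suc s) * X)) (sgn-suc s) ⟩
    (- sgn s) * factℚ s * (invFact (suc s) * X)
      ≡⟨ solve 4 (λ a f i x → (:- a) :* f :* (i :* x) := :- (a :* (f :* i) :* x)) refl (sgn s) (factℚ s) (invFact (suc s)) X ⟩
    - (sgn s * (factℚ s * invFact (suc s)) * X)
      ≡⟨ cong (λ z → - (sgn s * z * X)) (n!*invFact[1+n]≡1/[1+n] s) ⟩
    - (sgn s * (+ 1 / suc s) * X) ∎
    where X = (g ^ suc s) (suc k)

Bern*invFact≡todd : ∀ k → Bern k * invFact k ≡ todd k
Bern*invFact≡todd k = begin
  factℚ k * toddPow 1 k * invFact k
    ≡⟨ cong (λ t → factℚ k * t * invFact k) (trans (⊛-congʳ todd toddPow-zero k) (⊛-identityʳ todd k)) ⟩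
  factℚ k * todd k * invFact k
    ≡⟨ solve 3 (λ f t v → f :* t :* v := t :* (v :* f)) refl (factℚ k) (todd k) (invFact k) ⟩
  todd k * (invFact k * factℚ k)
    ≡⟨ cong (todd k *_) (invFact*factℚ≡1 k) ⟩
  todd k * 1ℚ
    ≡⟨ ℚP.*-identityʳ (todd k) ⟩
  todd k ∎
  where open ≡-Reasoning

lemma2p2 : (k m : ℕ) → .{{_ : NonZero k}} →
    LHS k m ≡ ((+ m) / 1) * sgn k * Bern k * invFact k * ((+ 1) / k)
lemma2p2 (suc k) m = begin
  LHS (suc k) m
    ≡⟨ LHS≡-logTrunc k m ⟩
  - logTrunc g k (suc k)
    ≡⟨ cong -_ (logTrunc-stable g g<1 (suc k) ℕP.≤-refl (ℕP.n≤1+n k)) ⟨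
  - log1p g (suc k)
    ≡⟨ cong -_ (θ-coeff-suc (log1p g) k) ⟩
  - (1/k * θ (log1p g) (suc k))
    ≡⟨ cong (λ z → - (1/k * z)) (θ-log a (expm1Over ^ m) h (toddPow-coeff₀ m) (expm1Over^m⊛toddPow m) (θ-toddPow m) (suc k)) ⟩
  - (1/k * (fromℕ m * (0ℚ + - (sgn (suc k) * todd (suc k)))))
    ≡⟨ cong (λ t → - (1/k * (fromℕ m * (0ℚ + - (sgn (suc k) * t))))) (Bern*invFact≡todd (suc k)) ⟨
  - (1/k * (fromℕ m * (0ℚ + - (sgn (suc k) * (Bern (suc k) * invFact (suc k))))))
    ≡⟨ solve 5 (λ i a s b f → :- (i :* (a :* (con 0ℚ :+ :- (s :* (b :* f))))) := a :* s :* b :* f :* i) refl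
         1/k (fromℕ m) (sgn (suc k)) (Bern (suc k)) (invFact (suc k)) ⟩
  fromℕ m * sgn (suc k) * Bern (suc k) * invFact (suc k) * 1/k ∎
  where
  open ≡-Reasoning
  a = toddPow m
  g = a ⊖ 𝟙
  g<1 = ⊖𝟙-vanishesBelow a (toddPow-coeff₀ m)
  h = fromℕ m · (𝟙 ⊖ σ todd)
  1/k = + 1 / suc k
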